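{- Let $\alpha^*\in(1/2,1)$ be the unique value satisfying $(\alpha^*)^{ -\alpha^*}(1-\alpha^*)^{\alpha^*-1}=2^{1/4}$ (i.e. $\alpha^*=\alpha(2^{ -3/4})$ where $\alpha(c)\in(1/2,1)$ solves $\alpha^{ -\alpha}(1-\alpha)^{\alpha-1}=2c$). Then every connected graph $G$ with at least two vertices and no vertex of degree $2$ satisfies $D(G)<\alpha^*<0.95831$.
   Context: All graphs are finite and simple. For a graph $G$, a non-empty set $S\subseteq V(G)$ is a connected set if $G[S]$ is connected. For an $n$-vertex connected graph $G$, the connected set density $D(G)$ is the average cardinality of the connected sets of $G$ divided by $n$. -}

module Defs where

open import Data.Nat using (ℕ; zero; suc; _+_; _*_; _∸_; _^_; _≤_; _<_)
open import Data.Bool using (Bool; true; false; T)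
open import Data.Fin using (Fin)
open import Data.Fin.Subset using (Subset; _∈_; ∣_∣; Nonempty)
open import Data.Vec using (tabulate)
open import Data.List using (List; map; length)
open import Data.Nat.ListAction using (sum)
open import Data.List.Relation.Unary.Unique.Propositional using (Unique)
import Data.List.Membership.Propositional as LM
open import Data.Product using (_×_)
open import Data.Sum using (_⊎_)
open import Relation.Binary.PropositionalEquality using (_≡_)
open import Function.Bundles using (_⇔_)

record Graph (n : ℕ) : Set where
  field
    adj   : Fin n → Fin n → Bool
    sym   : ∀ u v → adj u v ≡ adj v u
    irrefl : ∀ v → adj v v ≡ false
open Graph public

data WalkIn {n : ℕ} (G : Graph n) (S : Subset n) : Fin n → Fin n → Set where
  here : ∀ {u} → u ∈ S → WalkIn G S u u
  step : ∀ {u w v} → u ∈ S → T (adj G u w) → WalkIn G S w v → WalkIn G S u v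

ConnectedSet : ∀ {n} → Graph n → Subset n → Set
ConnectedSet {n} G S = Nonempty S × (∀ u v → u ∈ S → v ∈ S → WalkIn G S u v)

-- G is connected (n ≥ 1 is implied by non-emptiness of the vertex set).
ConnectedGraph : ∀ {n} → Graph n → Set
ConnectedGraph {n} G = ConnectedSet G (tabulate (λ _ → true))

degree : ∀ {n} → Graph n → Fin n → ℕ
degree G v = ∣ tabulate (adj G v) ∣

EnumeratesConnectedSets : ∀ {n} → Graph n → List (Subset n) → Set
EnumeratesConnectedSets {n} G L =
  Unique L × (∀ (S : Subset n) → (S LM.∈ L) ⇔ ConnectedSet G S)

totalSize : ∀ {n} → List (Subset n) → ℕ
totalSize L = sum (map ∣_∣ L)

-- Entropy-type quantity: for x = p/q with 0 ≤ p ≤ q,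
--   (x^{-x} (1-x)^{x-1})^{4q} = q^{4q} / (p^{4p} (q-p)^{4(q-p)}).
-- Compare with (2^{1/4})^{4q} = 2^q.
-- fPow4q-num p q = q^{4q};  fPow4q-den p q = p^{4p} (q-p)^{4(q-p)}.
fNum : ℕ → ℕ → ℕ
fNum p q = q ^ (4 * q)

fDen : ℕ → ℕ → ℕ
fDen p q = (p ^ (4 * p)) * ((q ∸ p) ^ (4 * (q ∸ p)))

-- The function f(α)=α^{-α}(1-α)^{α-1} is strictly decreasing on [1/2,1) (from 2 to 1),
-- so for a rational x = p/q (q > 0):
--   x < α*  iff  x ≤ 1/2  or  (x < 1 and f(x) > 2^{1/4})
--   α* < x  iff  x ≥ 1 or (1/2 < x and f(x) < 2^{1/4}).
LtAlphaStar : ℕ → ℕ → Set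
LtAlphaStar p q = (2 * p ≤ q) ⊎ (p < q × (2 ^ q) * fDen p q < fNum p q)

AlphaStarLt : ℕ → ℕ → Set
AlphaStarLt p q = (q ≤ p) ⊎ (q < 2 * p × fNum p q < (2 ^ q) * fDen p q)

-- Write the N connected sets of G, of total size T, as 0/1 vectors of length n. Splitting them on one
-- coordinate at a time and applying the log-sum inequality gives the entropy bound log N ≤ n h(T / nN),
-- i.e. f(T / nN) ^ (nN) ≥ N ^ N for f(α) = α ^ (-α) (1 - α) ^ (α - 1). On the other hand, growing a
-- connected set C with leaves X = N(C) ∖ C as in Kleitman and West's proof on spanning trees with many
-- leaves keeps |C| ≤ 2 |X| + #(dead leaves) as long as no vertex has degree 2. Once C ∪ X is everything,
-- n ≤ 4 |X|, and the sets C ∪ Y (Y ⊆ X) with one singleton give N > 2 ^ (n / 4). So f(D) ^ (4 nN) > 2 ^ (nN),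
-- that is f(D) > 2 ^ (1/4), which means D < α* since f decreases on [1/2, 1).

module Submission where

open import Defs hiding (sym)
open import Data.Nat
open import Data.Nat.Properties
open import Data.Nat.Tactic.RingSolver using (solve-∀)
open import Algebra.Properties.CommutativeSemigroup +-commutativeSemigroup using () renaming (interchange to +-interchange)
open import Data.Nat.Binary.Base using (ℕᵇ; 2[1+_]; 1+[2_]; toℕ; fromℕ)
open import Data.Nat.Binary.Properties using (toℕ-fromℕ)
open import Data.Bool using (Bool; true; false; T; _∧_; _∨_; not)
import Data.Bool as Bool
open import Data.Fin using (Fin; zero; suc)
import Data.Fin.Properties as Fin
open import Data.Vec using ([]; _∷_; here; there)
import Data.Vec as Vec
open import Data.Vec.Properties using ([]=⇒lookup; lookup⇒[]=; lookup∘tabulate)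
open import Data.List using (List; []; _∷_; length; map; _++_)
import Data.List as List
open import Data.List.Properties using (length-map; length-++)
open import Data.List.Membership.Propositional using () renaming (_∈_ to _∈ˡ_)
open import Data.List.Membership.Propositional.Properties using (∈-map⁻; ∈-++⁻; ∈-lookup)
open import Data.List.Relation.Unary.Any as Any using (here; there)
open import Data.List.Relation.Unary.Any.Properties using (lookup-index)
open import Data.List.Relation.Unary.Unique.Propositional.Properties using (map⁺; ++⁺)
open import Data.List.Relation.Unary.All as All using (All; []; _∷_)
open import Data.List.Relation.Unary.AllPairs using ([]; _∷_)
open import Data.List.Relation.Unary.Unique.Propositional using (Unique)
open import Data.Fin.Subset using (Subset; _∈_; _⊆_; _∪_; _∩_; ∁; ∣_∣; inside; outside; Empty; ⁅_⁆)
open import Data.Fin.Subset.Properties using (∣∁p∣≡n∸∣p∣; ∣p∣≤n; out⊆; s⊆s; x∈p∩q⁻; x∈p∪q⁻; x∈⁅x⁆; x∈⁅y⁆⇒x≡y)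
open import Relation.Nullary using (¬_; Dec; yes; no; does)
open import Relation.Nullary.Decidable using (dec-true; dec-false; _×-dec_)
open import Data.Bool.Properties using (∨-zeroʳ; ∨-identityʳ; ∧-zeroʳ; ∧-identityʳ; ¬-not; T-≡)
open import Data.Empty using (⊥-elim)
open import Function using (_∘_; case_of_)
open import Function.Bundles using (Equivalence)
open import Data.Product using (Σ; ∃; _×_; _,_; proj₁; proj₂)
open import Data.Sum using (_⊎_; inj₁; inj₂; [_,_]′)
open import Data.Unit using (tt)
open import Relation.Binary.PropositionalEquality

-- Weighted AM-GM and the log-sum inequality

^-distribʳ-* : ∀ m n k → (m * n) ^ k ≡ m ^ k * n ^ k
^-distribʳ-* m n zero    = refl
^-distribʳ-* m n (suc k) = trans (cong (m * n *_) (^-distribʳ-* m n k)) (shuffle m n (m ^ k) (n ^ k))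
  where
  shuffle : ∀ a b x y → a * b * (x * y) ≡ a * x * (b * y)
  shuffle = solve-∀

2xy≤x²+y² : ∀ x y → 2 * (x * y) ≤ x * x + y * y
2xy≤x²+y² x y = [ ordered , swapped ]′ (≤-total x y)
  where
  identity : ∀ x d → 2 * (x * (x + d)) + d * d ≡ x * x + (x + d) * (x + d)
  identity = solve-∀
  ordered : ∀ {x y} → x ≤ y → 2 * (x * y) ≤ x * x + y * y
  ordered {x} {y} x≤y = subst (λ y → 2 * (x * y) ≤ x * x + y * y) (m+[n∸m]≡n x≤y)
                          (≤-trans (m≤m+n _ _) (≤-reflexive (identity x (y ∸ x))))
  swapped : y ≤ x → 2 * (x * y) ≤ x * x + y * y
  swapped y≤x = subst₂ _≤_ (cong (2 *_) (*-comm y x)) (+-comm (y * y) (x * x)) (ordered y≤x)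

am-gm-one-vs-many : ∀ s x y → suc s * (x * y ^ s) ≤ x ^ suc s + s * y ^ suc s
am-gm-one-vs-many zero    x y = ≤-reflexive (trans (*-identityˡ _) (sym (+-identityʳ _)))
am-gm-one-vs-many (suc s) x y = +-cancelʳ-≤ (s * (x * (y * a))) _ _ (begin
    suc (suc s) * (x * (y * a)) + s * (x * (y * a))   ≡⟨ e₁ s x y a ⟩
    (suc s * a) * (2 * (x * y))                       ≤⟨ *-monoʳ-≤ (suc s * a) (2xy≤x²+y² x y) ⟩
    (suc s * a) * (x * x + y * y)                     ≡⟨ e₂ s x y a ⟩
    x * (suc s * (x * a)) + suc s * (y * (y * a))     ≤⟨ +-monoˡ-≤ _ (*-monoʳ-≤ x (am-gm-one-vs-many s x y)) ⟩
    x * (x ^ suc s + s * (y * a)) + suc s * (y * (y * a))  ≡⟨ e₃ s x y a (x ^ suc s) ⟩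
    (x * x ^ suc s + suc s * (y * (y * a))) + s * (x * (y * a))  ∎)
  where
  open ≤-Reasoning
  a = y ^ s
  e₁ : ∀ s x y a → suc (suc s) * (x * (y * a)) + s * (x * (y * a)) ≡ (suc s * a) * (2 * (x * y))
  e₁ = solve-∀
  e₂ : ∀ s x y a → (suc s * a) * (x * x + y * y) ≡ x * (suc s * (x * a)) + suc s * (y * (y * a))
  e₂ = solve-∀
  e₃ : ∀ s x y a P → x * (P + s * (y * a)) + suc s * (y * (y * a))
                     ≡ (x * P + suc s * (y * (y * a))) + s * (x * (y * a))
  e₃ = solve-∀

-- Weighted AM-GM for weights s and 1, at the point (S / s, v), cleared of denominators.
am-gm-weights-s-1 : ∀ s S v → suc s ^ suc s * (S ^ s * v) ≤ s ^ s * (S + v) ^ suc s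
am-gm-weights-s-1 zero    S v = subst₂ _≤_ (sym (*-identityˡ _)) (sym (trans (*-identityˡ _) (*-identityʳ _)))
                                  (≤-trans (≤-reflexive (+-identityʳ v)) (m≤n+m v S))
am-gm-weights-s-1 (suc k) S v = *-cancelˡ-≤ s (subst₂ _≤_ lhs rhs (+-cancelˡ-≤ _ _ _ shifted))
  where
  s = suc k
  x = s * (S + v)
  y = suc s * S
  expand : ∀ s S v a → suc s * (s * (S + v) * a) ≡ s * (suc s * S * a) + s * (suc s * a * v)
  expand = solve-∀
  shifted : s * (suc s * S * y ^ s) + s * (suc s * y ^ s * v) ≤ s * (suc s * S * y ^ s) + x ^ suc s
  shifted = subst₂ _≤_ (expand s S v (y ^ s)) (+-comm (x ^ suc s) _) (am-gm-one-vs-many s x y)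
  regroup : ∀ s a b v → s * (suc s * (a * b) * v) ≡ s * (suc s * a * (b * v))
  regroup = solve-∀
  lhs : s * (suc s * y ^ s * v) ≡ s * (suc s ^ suc s * (S ^ s * v))
  lhs = trans (cong (λ z → s * (suc s * z * v)) (^-distribʳ-* (suc s) S s)) (regroup s (suc s ^ s) (S ^ s) v)
  rhs : x ^ suc s ≡ s * (s ^ s * (S + v) ^ suc s)
  rhs = trans (^-distribʳ-* s (S + v) (suc s)) (*-assoc s (s ^ s) _)

x^x>0 : ∀ x → 0 < x ^ x
x^x>0 zero    = z<s
x^x>0 (suc x) = m^n>0 (suc x) (suc x)

weighted-am-gm : ∀ a b u v → (a + b) ^ (a + b) * (u ^ a * v ^ b) ≤ (a * u + b * v) ^ (a + b)
weighted-am-gm a zero    u v = ≤-reflexive (begin-equality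
  (a + 0) ^ (a + 0) * (u ^ a * 1)   ≡⟨ cong₂ (λ c w → c ^ c * w) (+-identityʳ a) (*-identityʳ (u ^ a)) ⟩
  a ^ a * u ^ a                     ≡⟨ sym (^-distribʳ-* a u a) ⟩
  (a * u) ^ a                       ≡⟨ cong₂ _^_ (sym (+-identityʳ (a * u))) (sym (+-identityʳ a)) ⟩
  (a * u + 0 * v) ^ (a + 0)         ∎)
  where open ≤-Reasoning
weighted-am-gm a (suc b) u v = subst₂ _≤_
    (cong₂ (λ c w → c ^ c * (u ^ a * w)) (sym (+-suc a b)) (*-comm (v ^ b) v))
    (cong₂ _^_ (regroup a b u v) (sym (+-suc a b)))
    (*-cancelˡ-≤ (s ^ s) {{>-nonZero (x^x>0 s)}} (begin
      s ^ s * (suc s ^ suc s * (u ^ a * (v ^ b * v)))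
        ≡⟨ shuffle (s ^ s) (suc s ^ suc s) (u ^ a) (v ^ b) v ⟩
      suc s ^ suc s * (s ^ s * (u ^ a * v ^ b)) * v
        ≤⟨ *-monoˡ-≤ v (*-monoʳ-≤ (suc s ^ suc s) (weighted-am-gm a b u v)) ⟩
      suc s ^ suc s * S ^ s * v
        ≡⟨ *-assoc (suc s ^ suc s) (S ^ s) v ⟩
      suc s ^ suc s * (S ^ s * v)
        ≤⟨ am-gm-weights-s-1 s S v ⟩
      s ^ s * (S + v) ^ suc s                           ∎))
  where
  open ≤-Reasoning
  s = a + b
  S = a * u + b * v
  shuffle : ∀ A B C D E → A * (B * (C * (D * E))) ≡ B * (A * (C * D)) * E
  shuffle = solve-∀
  regroup : ∀ a b u v → a * u + b * v + v ≡ a * u + suc b * v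
  regroup = solve-∀

log-sum : ∀ a₁ a₂ b₁ b₂ →
  (a₁ + a₂) ^ (a₁ + a₂) * (b₁ ^ a₁ * b₂ ^ a₂) ≤ (a₁ ^ a₁ * a₂ ^ a₂) * (b₁ + b₂) ^ (a₁ + a₂)
log-sum zero a₂ b₁ b₂ =
  subst₂ _≤_ (cong (a₂ ^ a₂ *_) (sym (+-identityʳ (b₂ ^ a₂))))
             (cong (_* (b₁ + b₂) ^ a₂) (sym (+-identityʳ (a₂ ^ a₂))))
    (*-monoʳ-≤ (a₂ ^ a₂) (^-monoˡ-≤ a₂ (m≤n+m b₂ b₁)))
log-sum a₁@(suc _) zero b₁ b₂ =
  subst₂ _≤_ (cong₂ (λ c w → c ^ c * w) (sym (+-identityʳ a₁)) (sym (*-identityʳ _)))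
             (cong₂ _*_ (sym (*-identityʳ (a₁ ^ a₁))) (cong ((b₁ + b₂) ^_) (sym (+-identityʳ a₁))))
    (*-monoʳ-≤ (a₁ ^ a₁) (^-monoˡ-≤ a₁ (m≤m+n b₁ b₂)))
log-sum a₁@(suc _) a₂@(suc _) b₁ b₂ =
  *-cancelˡ-≤ (r * t) {{>-nonZero (*-mono-≤ (m^n>0 a₂ a₁) (m^n>0 a₁ a₂))}}
    (subst₂ _≤_ lhs rhs (weighted-am-gm a₁ a₂ (b₁ * a₂) (b₂ * a₁)))
  where
  open ≤-Reasoning
  s = a₁ + a₂
  r = a₂ ^ a₁
  t = a₁ ^ a₂
  regroup : ∀ S p q r t → S * (p * r * (q * t)) ≡ r * t * (S * (p * q))
  regroup = solve-∀
  lhs : s ^ s * ((b₁ * a₂) ^ a₁ * (b₂ * a₁) ^ a₂) ≡ r * t * (s ^ s * (b₁ ^ a₁ * b₂ ^ a₂))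
  lhs = trans (cong₂ (λ x y → s ^ s * (x * y)) (^-distribʳ-* b₁ a₂ a₁) (^-distribʳ-* b₂ a₁ a₂))
              (regroup (s ^ s) (b₁ ^ a₁) (b₂ ^ a₂) r t)
  factor : ∀ a₁ a₂ b₁ b₂ → a₁ * (b₁ * a₂) + a₂ * (b₂ * a₁) ≡ a₁ * a₂ * (b₁ + b₂)
  factor = solve-∀
  regroup′ : ∀ A₁ t r A₂ B → A₁ * t * (r * A₂) * B ≡ r * t * (A₁ * A₂ * B)
  regroup′ = solve-∀
  rhs : (a₁ * (b₁ * a₂) + a₂ * (b₂ * a₁)) ^ s ≡ r * t * (a₁ ^ a₁ * a₂ ^ a₂ * (b₁ + b₂) ^ s)
  rhs = begin-equality
    (a₁ * (b₁ * a₂) + a₂ * (b₂ * a₁)) ^ s  ≡⟨ cong (_^ s) (factor a₁ a₂ b₁ b₂) ⟩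
    (a₁ * a₂ * (b₁ + b₂)) ^ s              ≡⟨ trans (^-distribʳ-* (a₁ * a₂) (b₁ + b₂) s)
                                                     (cong (_* (b₁ + b₂) ^ s) (^-distribʳ-* a₁ a₂ s)) ⟩
    a₁ ^ s * a₂ ^ s * (b₁ + b₂) ^ s        ≡⟨ cong₂ (λ x y → x * y * (b₁ + b₂) ^ s)
                                                     (^-distribˡ-+-* a₁ a₁ a₂) (^-distribˡ-+-* a₂ a₁ a₂) ⟩
    a₁ ^ a₁ * t * (r * a₂ ^ a₂) * (b₁ + b₂) ^ s  ≡⟨ regroup′ (a₁ ^ a₁) t r (a₂ ^ a₂) ((b₁ + b₂) ^ s) ⟩
    r * t * (a₁ ^ a₁ * a₂ ^ a₂ * (b₁ + b₂) ^ s)  ∎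

-- The entropy bound

m^[m*n]>0 : ∀ m n → 0 < m ^ (m * n)
m^[m*n]>0 zero    n = z<s
m^[m*n]>0 (suc m) n = m^n>0 (suc m) (suc m * n)

merge-branches : ∀ m N₀ N₁ T₀ T₁ Z₀ Z₁ → T₀ + Z₀ ≡ m * N₀ → T₁ + Z₁ ≡ m * N₁ →
  N₀ ^ N₀ * (T₀ ^ T₀ * Z₀ ^ Z₀) ≤ (m * N₀) ^ (m * N₀) →
  N₁ ^ N₁ * (T₁ ^ T₁ * Z₁ ^ Z₁) ≤ (m * N₁) ^ (m * N₁) →
  N₀ ^ N₀ * N₁ ^ N₁ * ((T₀ + T₁) ^ (T₀ + T₁) * (Z₀ + Z₁) ^ (Z₀ + Z₁)) ≤ (m * (N₀ + N₁)) ^ (m * (N₀ + N₁))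
merge-branches m N₀ N₁ T₀ T₁ Z₀ Z₁ e₀ e₁ h₀ h₁ =
  *-cancelʳ-≤ _ _ K {{>-nonZero K>0}} (begin
    N₀ ^ N₀ * N₁ ^ N₁ * (A ^ A * B ^ B) * K
      ≡⟨ shuffle₁ (N₀ ^ N₀) (N₁ ^ N₁) (A ^ A) (B ^ B) (T₀ ^ T₀) (T₁ ^ T₁) (Z₀ ^ Z₀) (Z₁ ^ Z₁) ⟩
    N₀ ^ N₀ * (T₀ ^ T₀ * Z₀ ^ Z₀) * (N₁ ^ N₁ * (T₁ ^ T₁ * Z₁ ^ Z₁)) * (A ^ A * B ^ B)
      ≤⟨ *-monoˡ-≤ (A ^ A * B ^ B) (*-mono-≤ (≤-trans h₀ (≤-reflexive split₀))
                                              (≤-trans h₁ (≤-reflexive split₁))) ⟩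
    m ^ (m * N₀) * (N₀ ^ T₀ * N₀ ^ Z₀) * (m ^ (m * N₁) * (N₁ ^ T₁ * N₁ ^ Z₁)) * (A ^ A * B ^ B)
      ≡⟨ shuffle₂ (m ^ (m * N₀)) (m ^ (m * N₁)) (N₀ ^ T₀) (N₀ ^ Z₀) (N₁ ^ T₁) (N₁ ^ Z₁) (A ^ A) (B ^ B) ⟩
    m ^ (m * N₀) * m ^ (m * N₁) * ((A ^ A * (N₀ ^ T₀ * N₁ ^ T₁)) * (B ^ B * (N₀ ^ Z₀ * N₁ ^ Z₁)))
      ≤⟨ *-monoʳ-≤ (m ^ (m * N₀) * m ^ (m * N₁)) (*-mono-≤ (log-sum T₀ T₁ N₀ N₁) (log-sum Z₀ Z₁ N₀ N₁)) ⟩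
    m ^ (m * N₀) * m ^ (m * N₁) * ((T₀ ^ T₀ * T₁ ^ T₁) * N ^ A * ((Z₀ ^ Z₀ * Z₁ ^ Z₁) * N ^ B))
      ≡⟨ shuffle₃ (m ^ (m * N₀)) (m ^ (m * N₁)) (T₀ ^ T₀) (T₁ ^ T₁) (Z₀ ^ Z₀) (Z₁ ^ Z₁) (N ^ A) (N ^ B) ⟩
    m ^ (m * N₀) * m ^ (m * N₁) * (N ^ A * N ^ B) * K
      ≡⟨ cong (_* K) collect ⟩
    (m * N) ^ (m * N) * K ∎)
  where
  open ≤-Reasoning
  N = N₀ + N₁
  A = T₀ + T₁
  B = Z₀ + Z₁
  K = (T₀ ^ T₀ * T₁ ^ T₁) * (Z₀ ^ Z₀ * Z₁ ^ Z₁)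
  K>0 : 0 < K
  K>0 = *-mono-≤ (*-mono-≤ (x^x>0 T₀) (x^x>0 T₁)) (*-mono-≤ (x^x>0 Z₀) (x^x>0 Z₁))
  split₀ : (m * N₀) ^ (m * N₀) ≡ m ^ (m * N₀) * (N₀ ^ T₀ * N₀ ^ Z₀)
  split₀ = trans (^-distribʳ-* m N₀ (m * N₀))
                 (cong (m ^ (m * N₀) *_) (trans (cong (N₀ ^_) (sym e₀)) (^-distribˡ-+-* N₀ T₀ Z₀)))
  split₁ : (m * N₁) ^ (m * N₁) ≡ m ^ (m * N₁) * (N₁ ^ T₁ * N₁ ^ Z₁)
  split₁ = trans (^-distribʳ-* m N₁ (m * N₁))
                 (cong (m ^ (m * N₁) *_) (trans (cong (N₁ ^_) (sym e₁)) (^-distribˡ-+-* N₁ T₁ Z₁)))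
  A+B≡m*N : A + B ≡ m * N
  A+B≡m*N = trans (+-interchange T₀ T₁ Z₀ Z₁) (trans (cong₂ _+_ e₀ e₁) (sym (*-distribˡ-+ m N₀ N₁)))
  collect : m ^ (m * N₀) * m ^ (m * N₁) * (N ^ A * N ^ B) ≡ (m * N) ^ (m * N)
  collect = begin-equality
    m ^ (m * N₀) * m ^ (m * N₁) * (N ^ A * N ^ B)
      ≡⟨ cong₂ _*_ (sym (^-distribˡ-+-* m (m * N₀) (m * N₁))) (sym (^-distribˡ-+-* N A B)) ⟩
    m ^ (m * N₀ + m * N₁) * N ^ (A + B)
      ≡⟨ cong₂ (λ i j → m ^ i * N ^ j) (sym (*-distribˡ-+ m N₀ N₁)) A+B≡m*N ⟩
    m ^ (m * N) * N ^ (m * N)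
      ≡⟨ sym (^-distribʳ-* m N (m * N)) ⟩
    (m * N) ^ (m * N)                                ∎
  shuffle₁ : ∀ n₀ n₁ a b t₀ t₁ z₀ z₁ →
    n₀ * n₁ * (a * b) * ((t₀ * t₁) * (z₀ * z₁)) ≡ n₀ * (t₀ * z₀) * (n₁ * (t₁ * z₁)) * (a * b)
  shuffle₁ = solve-∀
  shuffle₂ : ∀ M₀ M₁ x₀ y₀ x₁ y₁ a b →
    M₀ * (x₀ * y₀) * (M₁ * (x₁ * y₁)) * (a * b) ≡ M₀ * M₁ * ((a * (x₀ * x₁)) * (b * (y₀ * y₁)))
  shuffle₂ = solve-∀
  shuffle₃ : ∀ M₀ M₁ t₀ t₁ z₀ z₁ p q →
    M₀ * M₁ * ((t₀ * t₁) * p * ((z₀ * z₁) * q)) ≡ M₀ * M₁ * (p * q) * ((t₀ * t₁) * (z₀ * z₁))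
  shuffle₃ = solve-∀

add-coordinate : ∀ m N₀ N₁ A B → A + B ≡ m * (N₀ + N₁) →
  N₀ ^ N₀ * N₁ ^ N₁ * (A ^ A * B ^ B) ≤ (m * (N₀ + N₁)) ^ (m * (N₀ + N₁)) →
  (N₀ + N₁) ^ (N₀ + N₁) * ((A + N₁) ^ (A + N₁) * (B + N₀) ^ (B + N₀))
    ≤ (suc m * (N₀ + N₁)) ^ (suc m * (N₀ + N₁))
add-coordinate m N₀ N₁ A B A+B≡m*N h = begin
    N ^ N * P                             ≤⟨ *-monoʳ-≤ (N ^ N) P≤ ⟩
    N ^ N * (N ^ (m * N) * M)             ≡⟨ sym (*-assoc (N ^ N) _ M) ⟩
    N ^ N * N ^ (m * N) * M               ≡⟨ cong (_* M) (sym (^-distribˡ-+-* N N (m * N))) ⟩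
    N ^ (suc m * N) * M                   ≡⟨ *-comm (N ^ (suc m * N)) M ⟩
    suc m ^ (suc m * N) * N ^ (suc m * N) ≡⟨ sym (^-distribʳ-* (suc m) N (suc m * N)) ⟩
    (suc m * N) ^ (suc m * N)             ∎
  where
  open ≤-Reasoning
  N = N₀ + N₁
  P = (A + N₁) ^ (A + N₁) * (B + N₀) ^ (B + N₀)
  M = suc m ^ (suc m * N)
  -- log-sum with values (m, 1): the new coordinate is 1 on exactly the N₁ sets of the second branch.
  new-coordinate : ∀ A N₁ → (A + N₁) ^ (A + N₁) * m ^ A ≤ A ^ A * N₁ ^ N₁ * suc m ^ (A + N₁)
  new-coordinate A N₁ = subst₂ (λ w u → (A + N₁) ^ (A + N₁) * w ≤ A ^ A * N₁ ^ N₁ * u ^ (A + N₁))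
    (trans (cong (m ^ A *_) (^-zeroˡ N₁)) (*-identityʳ (m ^ A))) (+-comm m 1) (log-sum A N₁ m 1)
  exponents : A + N₁ + (B + N₀) ≡ suc m * N
  exponents = trans (regroup A B N₀ N₁) (trans (cong (_+ N) A+B≡m*N) (+-comm (m * N) N))
    where
    regroup : ∀ A B N₀ N₁ → A + N₁ + (B + N₀) ≡ A + B + (N₀ + N₁)
    regroup = solve-∀
  shuffle₁ : ∀ p q a b → p * q * (a * b) ≡ p * a * (q * b)
  shuffle₁ = solve-∀
  shuffle₂ : ∀ a n₁ b n₀ u v → a * n₁ * u * (b * n₀ * v) ≡ n₀ * n₁ * (a * b) * (u * v)
  shuffle₂ = solve-∀
  shuffle₃ : ∀ p q r → p * q * r ≡ q * r * p
  shuffle₃ = solve-∀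
  P≤ : P ≤ N ^ (m * N) * M
  P≤ = *-cancelʳ-≤ P _ (m ^ (m * N)) {{>-nonZero (m^[m*n]>0 m N)}} (begin
    P * m ^ (m * N)
      ≡⟨ cong (P *_) (trans (cong (m ^_) (sym A+B≡m*N)) (^-distribˡ-+-* m A B)) ⟩
    P * (m ^ A * m ^ B)
      ≡⟨ shuffle₁ ((A + N₁) ^ (A + N₁)) ((B + N₀) ^ (B + N₀)) (m ^ A) (m ^ B) ⟩
    (A + N₁) ^ (A + N₁) * m ^ A * ((B + N₀) ^ (B + N₀) * m ^ B)
                                             ≤⟨ *-mono-≤ (new-coordinate A N₁) (new-coordinate B N₀) ⟩
    A ^ A * N₁ ^ N₁ * suc m ^ (A + N₁) * (B ^ B * N₀ ^ N₀ * suc m ^ (B + N₀))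
                                             ≡⟨ shuffle₂ (A ^ A) (N₁ ^ N₁) (B ^ B) (N₀ ^ N₀) _ _ ⟩
    N₀ ^ N₀ * N₁ ^ N₁ * (A ^ A * B ^ B) * (suc m ^ (A + N₁) * suc m ^ (B + N₀))
                                             ≡⟨ cong (N₀ ^ N₀ * N₁ ^ N₁ * (A ^ A * B ^ B) *_)
                                                     (trans (sym (^-distribˡ-+-* (suc m) (A + N₁) (B + N₀))) (cong (suc m ^_) exponents)) ⟩
    N₀ ^ N₀ * N₁ ^ N₁ * (A ^ A * B ^ B) * M  ≤⟨ *-monoˡ-≤ M h ⟩
    (m * N) ^ (m * N) * M                    ≡⟨ cong (_* M) (^-distribʳ-* m N (m * N)) ⟩
    m ^ (m * N) * N ^ (m * N) * M            ≡⟨ shuffle₃ (m ^ (m * N)) (N ^ (m * N)) M ⟩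
    N ^ (m * N) * M * m ^ (m * N)            ∎)

zeros : ∀ {n} → List (Subset n) → ℕ
zeros F = totalSize (map ∁ F)

∣p∣+∣∁p∣≡n : ∀ {n} (p : Subset n) → ∣ p ∣ + ∣ ∁ p ∣ ≡ n
∣p∣+∣∁p∣≡n p = trans (cong (∣ p ∣ +_) (∣∁p∣≡n∸∣p∣ p)) (m+[n∸m]≡n (∣p∣≤n p))

totalSize+zeros : ∀ {n} (F : List (Subset n)) → totalSize F + zeros F ≡ n * length F
totalSize+zeros {n} []      = sym (*-zeroʳ n)
totalSize+zeros {n} (p ∷ F) = begin-equality
  ∣ p ∣ + totalSize F + (∣ ∁ p ∣ + zeros F)  ≡⟨ +-interchange (∣ p ∣) (totalSize F) (∣ ∁ p ∣) (zeros F) ⟩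
  ∣ p ∣ + ∣ ∁ p ∣ + (totalSize F + zeros F)  ≡⟨ cong₂ _+_ (∣p∣+∣∁p∣≡n p) (totalSize+zeros F) ⟩
  n + n * length F                            ≡⟨ sym (*-suc n (length F)) ⟩
  n * suc (length F)                          ∎
  where open ≤-Reasoning

module _ {n : ℕ} where

  omitting₀ containing₀ : List (Subset (suc n)) → List (Subset n)
  omitting₀ []                  = []
  omitting₀ ((outside ∷ p) ∷ F) = p ∷ omitting₀ F
  omitting₀ ((inside  ∷ p) ∷ F) = omitting₀ F
  containing₀ []                  = []
  containing₀ ((outside ∷ p) ∷ F) = containing₀ F
  containing₀ ((inside  ∷ p) ∷ F) = p ∷ containing₀ F

  length-split₀ : ∀ F → length F ≡ length (omitting₀ F) + length (containing₀ F)
  length-split₀ []                  = refl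
  length-split₀ ((outside ∷ p) ∷ F) = cong suc (length-split₀ F)
  length-split₀ ((inside  ∷ p) ∷ F) = trans (cong suc (length-split₀ F)) (sym (+-suc _ _))

  totalSize-split₀ : ∀ F →
    totalSize F ≡ totalSize (omitting₀ F) + totalSize (containing₀ F) + length (containing₀ F)
  totalSize-split₀ [] = refl
  totalSize-split₀ ((outside ∷ p) ∷ F) =
    trans (cong (∣ p ∣ +_) (totalSize-split₀ F))
          (regroup (∣ p ∣) (totalSize (omitting₀ F)) (totalSize (containing₀ F)) (length (containing₀ F)))
    where
    regroup : ∀ a b c d → a + (b + c + d) ≡ a + b + c + d
    regroup = solve-∀
  totalSize-split₀ ((inside ∷ p) ∷ F) =
    trans (cong (suc ∣ p ∣ +_) (totalSize-split₀ F))
          (regroup (∣ p ∣) (totalSize (omitting₀ F)) (totalSize (containing₀ F)) (length (containing₀ F)))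
    where
    regroup : ∀ a b c d → suc a + (b + c + d) ≡ b + (a + c) + suc d
    regroup = solve-∀

  zeros-split₀ : ∀ F → zeros F ≡ zeros (omitting₀ F) + zeros (containing₀ F) + length (omitting₀ F)
  zeros-split₀ [] = refl
  zeros-split₀ ((outside ∷ p) ∷ F) =
    trans (cong (suc ∣ ∁ p ∣ +_) (zeros-split₀ F))
          (regroup (∣ ∁ p ∣) (zeros (omitting₀ F)) (zeros (containing₀ F)) (length (omitting₀ F)))
    where
    regroup : ∀ a b c d → suc a + (b + c + d) ≡ a + b + c + suc d
    regroup = solve-∀
  zeros-split₀ ((inside ∷ p) ∷ F) =
    trans (cong (∣ ∁ p ∣ +_) (zeros-split₀ F))
          (regroup (∣ ∁ p ∣) (zeros (omitting₀ F)) (zeros (containing₀ F)) (length (omitting₀ F)))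
    where
    regroup : ∀ a b c d → a + (b + c + d) ≡ b + (a + c) + d
    regroup = solve-∀

  all-omitting₀ : ∀ {P : Subset (suc n) → Set} F → All P F → All (λ p → P (outside ∷ p)) (omitting₀ F)
  all-omitting₀ []                  []         = []
  all-omitting₀ ((outside ∷ p) ∷ F) (Pp ∷ PF) = Pp ∷ all-omitting₀ F PF
  all-omitting₀ ((inside  ∷ p) ∷ F) (Pp ∷ PF) = all-omitting₀ F PF

  all-containing₀ : ∀ {P : Subset (suc n) → Set} F → All P F → All (λ p → P (inside ∷ p)) (containing₀ F)
  all-containing₀ []                  []         = []
  all-containing₀ ((outside ∷ p) ∷ F) (Pp ∷ PF) = all-containing₀ F PF
  all-containing₀ ((inside  ∷ p) ∷ F) (Pp ∷ PF) = Pp ∷ all-containing₀ F PF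

  ∷-≢ : ∀ {b} {p q : Subset n} → ¬ (b ∷ p) ≡ (b ∷ q) → ¬ p ≡ q
  ∷-≢ b∷p≢b∷q refl = b∷p≢b∷q refl

  unique-omitting₀ : ∀ F → Unique F → Unique (omitting₀ F)
  unique-omitting₀ []                  []       = []
  unique-omitting₀ ((outside ∷ p) ∷ F) (p∉ ∷ u) = All.map ∷-≢ (all-omitting₀ F p∉) ∷ unique-omitting₀ F u
  unique-omitting₀ ((inside  ∷ p) ∷ F) (p∉ ∷ u) = unique-omitting₀ F u

  unique-containing₀ : ∀ F → Unique F → Unique (containing₀ F)
  unique-containing₀ []                  []       = []
  unique-containing₀ ((outside ∷ p) ∷ F) (p∉ ∷ u) = unique-containing₀ F u
  unique-containing₀ ((inside  ∷ p) ∷ F) (p∉ ∷ u) = All.map ∷-≢ (all-containing₀ F p∉) ∷ unique-containing₀ F u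

-- log N ≤ n h(T / nN) for the binary entropy h, multiplied by N and exponentiated.
entropy-bound : ∀ n (F : List (Subset n)) → Unique F →
  length F ^ length F * (totalSize F ^ totalSize F * zeros F ^ zeros F) ≤ (n * length F) ^ (n * length F)
entropy-bound zero [] _ = ≤-refl
entropy-bound zero ([] ∷ []) _ = ≤-refl
entropy-bound zero ([] ∷ [] ∷ F) ((≢[] ∷ _) ∷ _) with () ← ≢[] refl
entropy-bound (suc m) F u = subst₂ _≤_
  (cong₃ (λ a b c → a ^ a * (b ^ b * c ^ c))
         (sym (length-split₀ F)) (sym (totalSize-split₀ F)) (sym (zeros-split₀ F)))
  (cong (λ a → (suc m * a) ^ (suc m * a)) (sym (length-split₀ F)))
  (add-coordinate m N₀ N₁ (T₀ + T₁) (Z₀ + Z₁) A+B≡m*N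
    (merge-branches m N₀ N₁ T₀ T₁ Z₀ Z₁ (totalSize+zeros F₀) (totalSize+zeros F₁)
      (entropy-bound m F₀ (unique-omitting₀ F u)) (entropy-bound m F₁ (unique-containing₀ F u))))
  where
  F₀ = omitting₀ F
  F₁ = containing₀ F
  N₀ = length F₀
  N₁ = length F₁
  T₀ = totalSize F₀
  T₁ = totalSize F₁
  Z₀ = zeros F₀
  Z₁ = zeros F₁
  A+B≡m*N : T₀ + T₁ + (Z₀ + Z₁) ≡ m * (N₀ + N₁)
  A+B≡m*N = trans (+-interchange T₀ T₁ Z₀ Z₁)
              (trans (cong₂ _+_ (totalSize+zeros F₀) (totalSize+zeros F₁)) (sym (*-distribˡ-+ m N₀ N₁)))
  cong₃ : ∀ (f : ℕ → ℕ → ℕ → ℕ) {a a′ b b′ c c′} → a ≡ a′ → b ≡ b′ → c ≡ c′ → f a b c ≡ f a′ b′ c′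
  cong₃ f refl refl refl = refl

^[4*k]≡[^k]^4 : ∀ x k → x ^ (4 * k) ≡ (x ^ k) ^ 4
^[4*k]≡[^k]^4 x k = trans (cong (x ^_) (*-comm 4 k)) (sym (^-*-assoc x k 4))

-- f(T / q) ^ q = q ^ q / (T ^ T Z ^ Z) ≥ N ^ N by the entropy bound, so f(T / q) ^ (4 q) ≥ N ^ (4 N) > 2 ^ q.
density<α* : ∀ n N T Z → T + Z ≡ n * N → N ^ N * (T ^ T * Z ^ Z) ≤ (n * N) ^ (n * N) → 2 ^ n < N ^ 4 →
  LtAlphaStar T (n * N)
density<α* n N T Z T+Z≡q entropy 2ⁿ<N⁴ with 2 * T ≤? n * N
... | yes 2T≤q = inj₁ 2T≤q
... | no _ = inj₂ (≤∧≢⇒< T≤q T≢q , 2^q*fDen<fNum)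
  where
  open ≤-Reasoning
  q = n * N
  T≤q : T ≤ q
  T≤q = subst (T ≤_) T+Z≡q (m≤m+n T Z)
  instance
    N≢0 : NonZero N
    N≢0 = ≢-nonZero λ { refl → <⇒≱ 2ⁿ<N⁴ z≤n }
  2^q<[N^N]^4 : 2 ^ q < (N ^ N) ^ 4
  2^q<[N^N]^4 = begin-strict
    2 ^ (n * N)    ≡⟨ sym (^-*-assoc 2 n N) ⟩
    (2 ^ n) ^ N    <⟨ ^-monoˡ-< N 2ⁿ<N⁴ ⟩
    (N ^ 4) ^ N    ≡⟨ trans (^-*-assoc N 4 N) (^[4*k]≡[^k]^4 N N) ⟩
    (N ^ N) ^ 4    ∎
  fDen≡ : fDen T q ≡ (T ^ T * Z ^ Z) ^ 4
  fDen≡ = trans (cong₂ _*_ (^[4*k]≡[^k]^4 T T) (trans (cong (λ z → z ^ (4 * z)) (q∸T≡Z)) (^[4*k]≡[^k]^4 Z Z)))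
                (sym (^-distribʳ-* (T ^ T) (Z ^ Z) 4))
    where
    q∸T≡Z : q ∸ T ≡ Z
    q∸T≡Z = trans (cong (_∸ T) (sym T+Z≡q)) (m+n∸m≡n T Z)
  2^q*fDen<fNum : 2 ^ q * fDen T q < fNum T q
  2^q*fDen<fNum = begin-strict
    2 ^ q * fDen T q
      ≡⟨ cong (2 ^ q *_) fDen≡ ⟩
    2 ^ q * (T ^ T * Z ^ Z) ^ 4
      <⟨ *-monoˡ-< _ {{m^n≢0 _ 4 {{>-nonZero (*-mono-≤ (x^x>0 T) (x^x>0 Z))}}}} 2^q<[N^N]^4 ⟩
    (N ^ N) ^ 4 * (T ^ T * Z ^ Z) ^ 4
      ≡⟨ sym (^-distribʳ-* (N ^ N) (T ^ T * Z ^ Z) 4) ⟩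
    (N ^ N * (T ^ T * Z ^ Z)) ^ 4
      ≤⟨ ^-monoˡ-≤ 4 entropy ⟩
    (q ^ q) ^ 4
      ≡⟨ sym (^[4*k]≡[^k]^4 q q) ⟩
    fNum T q                      ∎
  T≢q : T ≢ q
  T≢q refl = <⇒≱ 2^q*fDen<fNum (begin
    fNum T T                 ≡⟨ sym (*-identityʳ _) ⟩
    fNum T T * 1             ≡⟨ cong (λ z → fNum T T * z ^ (4 * z)) (sym (n∸n≡0 T)) ⟩
    fDen T T                 ≤⟨ m≤n*m (fDen T T) (2 ^ T) {{m^n≢0 2 T}} ⟩
    2 ^ T * fDen T T         ∎)

-- Vertex sets as indicator functions, and walks

∨-introˡ : ∀ {a b} → a ≡ true → a ∨ b ≡ true
∨-introˡ refl = refl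

∨-introʳ : ∀ {a b} → b ≡ true → a ∨ b ≡ true
∨-introʳ {a} refl = ∨-zeroʳ a

∨-elim : ∀ {a b} → a ∨ b ≡ true → a ≡ true ⊎ b ≡ true
∨-elim {true}  _ = inj₁ refl
∨-elim {false} e = inj₂ e

∨-falseˡ : ∀ {a b} → a ∨ b ≡ false → a ≡ false
∨-falseˡ {false} _ = refl

∨-falseʳ : ∀ {a b} → a ∨ b ≡ false → b ≡ false
∨-falseʳ {false} e = e

∧-intro : ∀ {a b} → a ≡ true → b ≡ true → a ∧ b ≡ true
∧-intro refl refl = refl

∧-elim : ∀ {a b} → a ∧ b ≡ true → a ≡ true × b ≡ true
∧-elim {true} {true} _ = refl , refl

not-introᶠ : ∀ {a} → a ≡ false → not a ≡ true
not-introᶠ refl = refl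

not-elimᵗ : ∀ {a} → not a ≡ true → a ≡ false
not-elimᵗ {false} _ = refl

≢true⇒≡false : ∀ {a} → a ≢ true → a ≡ false
≢true⇒≡false {a} = ¬-not {a} {true}

true≢false : true ≢ false
true≢false ()

Indicator : ℕ → Set
Indicator n = Fin n → Bool

bit : Bool → ℕ
bit true  = 1
bit false = 0

count : ∀ {n} → Indicator n → ℕ
count {zero}  f = 0
count {suc n} f = bit (f zero) + count (f ∘ suc)

_⊆ᵢ_ : ∀ {n} → Indicator n → Indicator n → Set
f ⊆ᵢ g = ∀ i → f i ≡ true → g i ≡ true

_∪ᵢ_ : ∀ {n} → Indicator n → Indicator n → Indicator n
(f ∪ᵢ g) i = f i ∨ g i

⁅_⁆ᵢ : ∀ {n} → Fin n → Indicator n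
⁅ x ⁆ᵢ v = does (v Fin.≟ x)

x∈⁅x⁆ᵢ : ∀ {n} (x : Fin n) → ⁅ x ⁆ᵢ x ≡ true
x∈⁅x⁆ᵢ x = dec-true (x Fin.≟ x) refl

does⇒ : ∀ {a} {A : Set a} (A? : Dec A) → does A? ≡ true → A
does⇒ (yes a) _ = a

x∈⁅y⁆ᵢ⇒x≡y : ∀ {n} {x y : Fin n} → ⁅ y ⁆ᵢ x ≡ true → x ≡ y
x∈⁅y⁆ᵢ⇒x≡y {x = x} {y} = does⇒ (x Fin.≟ y)

x≢y⇒x∉⁅y⁆ᵢ : ∀ {n} {x y : Fin n} → x ≢ y → ⁅ y ⁆ᵢ x ≡ false
x≢y⇒x∉⁅y⁆ᵢ {x = x} {y} = dec-false (x Fin.≟ y)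

count-tabulate : ∀ {n} (f : Indicator n) → ∣ Vec.tabulate f ∣ ≡ count f
count-tabulate {zero}  f = refl
count-tabulate {suc n} f with f zero
... | true  = cong suc (count-tabulate (f ∘ suc))
... | false = count-tabulate (f ∘ suc)

count-all : ∀ n → count {n} (λ _ → true) ≡ n
count-all zero    = refl
count-all (suc n) = cong suc (count-all n)

count-none : ∀ {n} (f : Indicator n) → (∀ i → f i ≡ false) → count f ≡ 0
count-none {zero}  f f≡false = refl
count-none {suc n} f f≡false rewrite f≡false zero = count-none (f ∘ suc) (f≡false ∘ suc)

bit-mono : ∀ {a b} → (a ≡ true → b ≡ true) → bit a ≤ bit b
bit-mono {false}     _   = z≤n
bit-mono {true}  {b} a⇒b rewrite a⇒b refl = ≤-refl

count-mono : ∀ {n} {f g : Indicator n} → f ⊆ᵢ g → count f ≤ count g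
count-mono {zero}  f⊆g = z≤n
count-mono {suc n} f⊆g = +-mono-≤ (bit-mono (f⊆g zero)) (count-mono (f⊆g ∘ suc))

count-cong : ∀ {n} {f g : Indicator n} → (∀ i → f i ≡ g i) → count f ≡ count g
count-cong f≗g = ≤-antisym (count-mono (λ i e → trans (sym (f≗g i)) e)) (count-mono (λ i e → trans (f≗g i) e))

count-strict : ∀ {n} {f g : Indicator n} → f ⊆ᵢ g → ∀ w → g w ≡ true → f w ≡ false → count f < count g
count-strict {suc n} {f} {g} f⊆g zero    gw fw rewrite gw | fw = s≤s (count-mono (f⊆g ∘ suc))
count-strict {suc n} {f} {g} f⊆g (suc w) gw fw = ≤-trans (≤-reflexive (sym (+-suc _ _)))
  (+-mono-≤ (bit-mono (f⊆g zero)) (count-strict (f⊆g ∘ suc) w gw fw))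

count>0 : ∀ {n} (f : Indicator n) w → f w ≡ true → 0 < count f
count>0 {n} f w fw = ≤-trans (≤-reflexive (cong suc (sym (count-none {n} (λ _ → false) (λ _ → refl)))))
  (count-strict (λ _ ()) w fw refl)

count>0⇒witness : ∀ {n} (f : Indicator n) → 0 < count f → ∃ λ v → f v ≡ true
count>0⇒witness {suc n} f h with f zero in f0
... | true  = zero , f0
... | false = let (v , fv) = count>0⇒witness (f ∘ suc) h in suc v , fv

count≥2⇒witness≢ : ∀ {n} (f : Indicator n) → 2 ≤ count f → ∀ x → ∃ λ v → f v ≡ true × v ≢ x
count≥2⇒witness≢ {suc n} f h x with f zero in f0 | x
... | true  | zero  = let (v , fv) = count>0⇒witness (f ∘ suc) (≤-pred h) in suc v , fv , λ ()
... | true  | suc _ = zero , f0 , λ ()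
... | false | zero  = let (v , fv) = count>0⇒witness (f ∘ suc) (≤-trans (s≤s z≤n) h) in suc v , fv , λ ()
... | false | suc x′ = let (v , fv , v≢x′) = count≥2⇒witness≢ (f ∘ suc) h x′ in suc v , fv , v≢x′ ∘ Fin.suc-injective

bit-∨ : ∀ a b → (a ≡ true → b ≡ false) → bit (a ∨ b) ≡ bit a + bit b
bit-∨ true  b disj rewrite disj refl = refl
bit-∨ false b disj = refl

bit-∨-≤ : ∀ a b → bit (a ∨ b) ≤ bit a + bit b
bit-∨-≤ true  true  = s≤s z≤n
bit-∨-≤ true  false = ≤-refl
bit-∨-≤ false b     = ≤-refl

count-∪-disjoint : ∀ {n} (f g : Indicator n) → (∀ i → f i ≡ true → g i ≡ false) → count (f ∪ᵢ g) ≡ count f + count g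
count-∪-disjoint {zero}  f g disj = refl
count-∪-disjoint {suc n} f g disj =
  trans (cong₂ _+_ (bit-∨ (f zero) (g zero) (disj zero)) (count-∪-disjoint (f ∘ suc) (g ∘ suc) (disj ∘ suc)))
        (+-interchange (bit (f zero)) (bit (g zero)) (count (f ∘ suc)) (count (g ∘ suc)))

count-∪ : ∀ {n} (f g : Indicator n) → count (f ∪ᵢ g) ≤ count f + count g
count-∪ {zero}  f g = z≤n
count-∪ {suc n} f g = ≤-trans (+-mono-≤ (bit-∨-≤ (f zero) (g zero)) (count-∪ (f ∘ suc) (g ∘ suc)))
                              (≤-reflexive (+-interchange (bit (f zero)) (bit (g zero)) (count (f ∘ suc)) (count (g ∘ suc))))

count-⁅⁆ᵢ : ∀ {n} (x : Fin n) → count ⁅ x ⁆ᵢ ≡ 1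
count-⁅⁆ᵢ {suc n} zero    = cong suc (count-none {n} _ (λ _ → refl))
count-⁅⁆ᵢ {suc n} (suc x) = count-⁅⁆ᵢ x

count-insert : ∀ {n} (f : Indicator n) x → f x ≡ false → count (f ∪ᵢ ⁅ x ⁆ᵢ) ≡ suc (count f)
count-insert f x fx =
  trans (count-∪-disjoint f ⁅ x ⁆ᵢ f∩⁅x⁆=∅) (trans (cong (count f +_) (count-⁅⁆ᵢ x)) (+-comm (count f) 1))
  where
  f∩⁅x⁆=∅ : ∀ i → f i ≡ true → ⁅ x ⁆ᵢ i ≡ false
  f∩⁅x⁆=∅ i fi = x≢y⇒x∉⁅y⁆ᵢ {x = i} {x} λ { refl → ⊥-elim (true≢false (trans (sym fi) fx)) }

count-remove : ∀ {n} (f : Indicator n) x → f x ≡ true → suc (count (λ v → f v ∧ not (⁅ x ⁆ᵢ v))) ≡ count f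
count-remove f x fx = trans (sym (count-insert f∖x x f∖x[x]≡false)) (count-cong restore)
  where
  f∖x : Indicator _
  f∖x v = f v ∧ not (⁅ x ⁆ᵢ v)
  f∖x[x]≡false : f∖x x ≡ false
  f∖x[x]≡false rewrite x∈⁅x⁆ᵢ x = ∧-zeroʳ (f x)
  restore : ∀ v → (f∖x ∪ᵢ ⁅ x ⁆ᵢ) v ≡ f v
  restore v with v Fin.≟ x
  ... | yes refl rewrite fx = refl
  ... | no _ = trans (∨-identityʳ _) (∧-identityʳ (f v))

count≤1⇒unique : ∀ {n} (f : Indicator n) → count f ≤ 1 → ∀ {a b} → f a ≡ true → f b ≡ true → a ≡ b
count≤1⇒unique f count≤1 {a} {b} fa fb with a Fin.≟ b
... | yes a≡b = a≡b
... | no  a≢b = ⊥-elim (<⇒≱ (s≤s count≤1) (≤-trans (s≤s (count>0 ⁅ a ⁆ᵢ a (x∈⁅x⁆ᵢ a)))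
                                                    (count-strict ⁅a⁆⊆f b fb (x≢y⇒x∉⁅y⁆ᵢ (a≢b ∘ sym)))))
  where
  ⁅a⁆⊆f : ⁅ a ⁆ᵢ ⊆ᵢ f
  ⁅a⁆⊆f i i∈⁅a⁆ rewrite x∈⁅y⁆ᵢ⇒x≡y {x = i} {a} i∈⁅a⁆ = fa

∈-tabulate⁺ : ∀ {n} (f : Indicator n) i → f i ≡ true → i ∈ Vec.tabulate f
∈-tabulate⁺ f i fi = lookup⇒[]= i (Vec.tabulate f) (trans (lookup∘tabulate f i) fi)

∈-tabulate⁻ : ∀ {n} (f : Indicator n) i → i ∈ Vec.tabulate f → f i ≡ true
∈-tabulate⁻ f i i∈f = trans (sym (lookup∘tabulate f i)) ([]=⇒lookup i∈f)

module _ {n : ℕ} (G : Graph n) where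

  walk-mono : ∀ {S S′ : Subset n} → (∀ i → i ∈ S → i ∈ S′) → ∀ {u v} → WalkIn G S u v → WalkIn G S′ u v
  walk-mono S⊆S′ (here u∈S)       = here (S⊆S′ _ u∈S)
  walk-mono S⊆S′ (step u∈S uw wv) = step (S⊆S′ _ u∈S) uw (walk-mono S⊆S′ wv)

  walk-snoc : ∀ {S u w v} → WalkIn G S u w → T (adj G w v) → v ∈ S → WalkIn G S u v
  walk-snoc (here u∈S)       wv v∈S = step u∈S wv (here v∈S)
  walk-snoc (step u∈S uw′ w′w) wv v∈S = step u∈S uw′ (walk-snoc w′w wv v∈S)

  walk-reverse : ∀ {S u v} → WalkIn G S u v → WalkIn G S v u
  walk-reverse (here u∈S) = here u∈S
  walk-reverse {u = u} (step {w = w} u∈S uw wv) = walk-snoc (walk-reverse wv) (subst T (Graph.sym G u w) uw) u∈S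

  walk-++ : ∀ {S u w v} → WalkIn G S u w → WalkIn G S w v → WalkIn G S u v
  walk-++ (here _)         wv  = wv
  walk-++ (step u∈S uw′ w′w) wv = step u∈S uw′ (walk-++ w′w wv)

  crossing-edge : ∀ (K : Indicator n) {S u w} → WalkIn G S u w → K u ≡ true → K w ≡ false →
    ∃ λ a → ∃ λ b → K a ≡ true × K b ≡ false × adj G a b ≡ true
  crossing-edge K (here _) Ku Kw = ⊥-elim (true≢false (trans (sym Ku) Kw))
  crossing-edge K {u = u} (step {w = w′} _ uw′ w′w) Ku Kw with K w′ in Kw′
  ... | true  = crossing-edge K w′w Kw′ Kw
  ... | false = u , w′ , Ku , Kw′ , T-≡ .Equivalence.to uw′

-- Kleitman–West leaf growing

budget-by-new-leaves : ∀ {c a a′ d d′ k} → c ≤ 2 * a + d → suc a′ ≡ a + k → 2 ≤ k → d ≤ d′ →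
  2 + c ≤ 2 * a′ + d′
budget-by-new-leaves {c} {a} {a′} {d} {d′} {k} budget a′≡a+k-1 2≤k d≤d′ = begin
  2 + c              ≤⟨ +-monoʳ-≤ 2 budget ⟩
  2 + (2 * a + d)    ≡⟨ regroup a d ⟩
  2 * suc a + d      ≤⟨ +-mono-≤ (*-monoʳ-≤ 2 a<a′) d≤d′ ⟩
  2 * a′ + d′        ∎
  where
  open ≤-Reasoning
  regroup : ∀ a d → 2 + (2 * a + d) ≡ 2 * suc a + d
  regroup = solve-∀
  a<a′ : suc a ≤ a′
  a<a′ = ≤-pred (subst₂ _≤_ (+-comm a 2) (sym a′≡a+k-1) (+-monoʳ-≤ a 2≤k))

budget-by-new-dead-leaf : ∀ {c a a′ d d′} → c ≤ 2 * a + d → suc a′ ≡ a + 1 → d < d′ → suc c ≤ 2 * a′ + d′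
budget-by-new-dead-leaf {c} {a} {a′} {d} {d′} budget a′≡a d<d′ = begin
  suc c
    ≤⟨ s≤s budget ⟩
  suc (2 * a + d)
    ≡⟨ sym (+-suc (2 * a) d) ⟩
  2 * a + suc d
    ≤⟨ +-mono-≤ (≤-reflexive (cong (2 *_) (suc-injective (trans (+-comm 1 a) (sym a′≡a))))) d<d′ ⟩
  2 * a′ + d′        ∎
  where open ≤-Reasoning

module LeafyTrees {n : ℕ} (G : Graph n) where

  _~_ : Fin n → Fin n → Bool
  u ~ v = adj G u v

  ~-sym : ∀ {u v} → u ~ v ≡ true → v ~ u ≡ true
  ~-sym {u} {v} uv = trans (Graph.sym G v u) uv

  outNbrs : Indicator n → Indicator n → Fin n → Indicator n
  outNbrs C X x v = (x ~ v) ∧ not ((C ∪ᵢ X) v)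

  deadLeaves : Indicator n → Indicator n → Indicator n
  deadLeaves C X x = X x ∧ does (count (outNbrs C X x) ≟ 0)

  -- C is a connected set around the root and X = N(C) ∖ C its leaves; the budget is the potential of the
  -- Kleitman–West argument for spanning trees with many leaves, a leaf being dead once it has no neighbour
  -- outside C ∪ X.
  record LeafyTree : Set where
    field
      C X      : Indicator n
      root     : Fin n
      root∈C   : C root ≡ true
      disjoint : ∀ v → C v ≡ true → X v ≡ false
      closed   : ∀ c v → C c ≡ true → c ~ v ≡ true → (C ∪ᵢ X) v ≡ true
      attached : ∀ x → X x ≡ true → ∃ λ c → C c ≡ true × c ~ x ≡ true
      reach    : ∀ c → C c ≡ true → WalkIn G (Vec.tabulate C) root c
      budget   : count C ≤ 2 * count X + count (deadLeaves C X)

  tree : LeafyTree → Indicator n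
  tree s = LeafyTree.C s ∪ᵢ LeafyTree.X s

  deadLeaves-mono : ∀ {C X C′ X′ x} → (C ∪ᵢ X) ⊆ᵢ (C′ ∪ᵢ X′) → (∀ v → X v ≡ true → v ≢ x → X′ v ≡ true) →
    deadLeaves C X x ≡ false → deadLeaves C X ⊆ᵢ deadLeaves C′ X′
  deadLeaves-mono {C} {X} {C′} {X′} {x} grows keeps x-alive v v-dead =
    ∧-intro (keeps v Xv v≢x) (dec-true (_ ≟ 0) (n≤0⇒n≡0 (subst (_ ≤_) out≡0 (count-mono out′⊆out))))
    where
    Xv = proj₁ (∧-elim {X v} v-dead)
    out≡0 : count (outNbrs C X v) ≡ 0
    out≡0 = does⇒ (_ ≟ 0) (proj₂ (∧-elim {X v} v-dead))
    v≢x : v ≢ x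
    v≢x refl = true≢false (trans (sym v-dead) x-alive)
    out′⊆out : outNbrs C′ X′ v ⊆ᵢ outNbrs C X v
    out′⊆out w out′ = ∧-intro (proj₁ e) (not-introᶠ (≢true⇒≡false λ inTree →
                                true≢false (trans (sym (grows w inTree)) (not-elimᵗ (proj₂ e)))))
      where e = ∧-elim {v ~ w} out′

  deadLeaf⁺ : ∀ {C X w} → X w ≡ true → (∀ v → outNbrs C X w v ≡ false) → deadLeaves C X w ≡ true
  deadLeaf⁺ {C} {X} {w} Xw no-out = ∧-intro Xw (dec-true (_ ≟ 0) (count-none (outNbrs C X w) no-out))

  walk-lift : ∀ {C C′ : Indicator n} → C ⊆ᵢ C′ →
    ∀ {u v} → WalkIn G (Vec.tabulate C) u v → WalkIn G (Vec.tabulate C′) u v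
  walk-lift {C} {C′} C⊆C′ = walk-mono G (λ i i∈C → ∈-tabulate⁺ C′ i (C⊆C′ i (∈-tabulate⁻ C i i∈C)))

  Progress : LeafyTree → Set
  Progress s = Σ LeafyTree λ s′ → count (tree s) < count (tree s′)

  -- Turn the leaf x into an inner vertex together with the fresh vertices Q ∖ {x}, and add the leaves P.
  module Grow (s : LeafyTree) (x : Fin n) (Q P : Indicator n) (x∈Q : Q x ≡ true) where
    open LeafyTree s

    C′ X′ : Indicator n
    C′ = C ∪ᵢ Q
    X′ v = (X v ∨ P v) ∧ not (⁅ x ⁆ᵢ v)

    C⊆C′ : C ⊆ᵢ C′
    C⊆C′ v = ∨-introˡ

    X′-keeps : ∀ v → X v ≡ true → v ≢ x → X′ v ≡ true
    X′-keeps v Xv v≢x = ∧-intro (∨-introˡ Xv) (not-introᶠ (x≢y⇒x∉⁅y⁆ᵢ v≢x))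

    X′-gains : ∀ v → P v ≡ true → v ≢ x → X′ v ≡ true
    X′-gains v Pv v≢x = ∧-intro (∨-introʳ {X v} Pv) (not-introᶠ (x≢y⇒x∉⁅y⁆ᵢ v≢x))

    x∈C′ : C′ x ≡ true
    x∈C′ = ∨-introʳ {C x} x∈Q

    tree⊆tree′ : (C ∪ᵢ X) ⊆ᵢ (C′ ∪ᵢ X′)
    tree⊆tree′ v inTree with ∨-elim {C v} inTree | v Fin.≟ x
    ... | inj₁ Cv | _        = ∨-introˡ (∨-introˡ Cv)
    ... | inj₂ _  | yes refl = ∨-introˡ x∈C′
    ... | inj₂ Xv | no _     = ∨-introʳ {C′ v} (∧-intro (∨-introˡ Xv) refl)

    P⊆tree′ : ∀ v → P v ≡ true → (C′ ∪ᵢ X′) v ≡ true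
    P⊆tree′ v Pv with v Fin.≟ x
    ... | yes refl = ∨-introˡ x∈C′
    ... | no _     = ∨-introʳ {C′ v} (∧-intro (∨-introʳ {X v} Pv) refl)

    Q⊆tree′ : ∀ v → Q v ≡ true → (C′ ∪ᵢ X′) v ≡ true
    Q⊆tree′ v Qv = ∨-introˡ (∨-introʳ {C v} Qv)

    progress : ∀ w → (C′ ∪ᵢ X′) w ≡ true → (C ∪ᵢ X) w ≡ false → count (C ∪ᵢ X) < count (C′ ∪ᵢ X′)
    progress = count-strict tree⊆tree′

    count-X′ : X x ≡ true → (∀ v → P v ≡ true → X v ≡ false) → suc (count X′) ≡ count X + count P
    count-X′ Xx P∩X=∅ = trans (count-remove (X ∪ᵢ P) x (∨-introˡ Xx)) (count-∪-disjoint X P X∩P=∅)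
      where
      X∩P=∅ : ∀ v → X v ≡ true → P v ≡ false
      X∩P=∅ v Xv = ≢true⇒≡false λ Pv → true≢false (trans (sym Xv) (P∩X=∅ v Pv))

    deadLeaves⊆ : deadLeaves C X x ≡ false → deadLeaves C X ⊆ᵢ deadLeaves C′ X′
    deadLeaves⊆ = deadLeaves-mono tree⊆tree′ X′-keeps

    grow : (fresh : ∀ v → Q v ≡ true → v ≢ x → (C ∪ᵢ X) v ≡ false × P v ≡ false)
           (P∩C=∅ : ∀ v → P v ≡ true → C v ≡ false)
           (Q-closed : ∀ c v → Q c ≡ true → c ~ v ≡ true → (C ∪ᵢ X) v ≡ true ⊎ P v ≡ true ⊎ Q v ≡ true)
           (P-attached : ∀ v → P v ≡ true → ∃ λ c → Q c ≡ true × c ~ v ≡ true)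
           (Q-reach : ∀ c → Q c ≡ true → WalkIn G (Vec.tabulate C′) root c)
           (budget′ : count C′ ≤ 2 * count X′ + count (deadLeaves C′ X′)) →
           LeafyTree
    grow fresh P∩C=∅ Q-closed P-attached Q-reach budget′ = record
      { C = C′ ; X = X′ ; root = root ; root∈C = ∨-introˡ root∈C ; disjoint = disjoint′
      ; closed = closed′ ; attached = attached′ ; reach = reach′ ; budget = budget′ }
      where
      C∩P=∅ : ∀ v → C v ≡ true → P v ≡ false
      C∩P=∅ v Cv = ≢true⇒≡false λ Pv → true≢false (trans (sym Cv) (P∩C=∅ v Pv))
      disjoint′ : ∀ v → C′ v ≡ true → X′ v ≡ false
      disjoint′ v C′v with v Fin.≟ x | ∨-elim {C v} C′v
      ... | yes refl | _ = ∧-zeroʳ (X x ∨ P x)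
      ... | no v≢x | inj₁ Cv rewrite disjoint v Cv | C∩P=∅ v Cv = refl
      ... | no v≢x | inj₂ Qv
        rewrite proj₂ (fresh v Qv v≢x) | ∨-falseʳ {C v} (proj₁ (fresh v Qv v≢x)) = refl
      closed′ : ∀ c v → C′ c ≡ true → c ~ v ≡ true → (C′ ∪ᵢ X′) v ≡ true
      closed′ c v C′c cv with ∨-elim {C c} C′c
      ... | inj₁ Cc = tree⊆tree′ v (closed c v Cc cv)
      ... | inj₂ Qc with Q-closed c v Qc cv
      ...   | inj₁ inTree      = tree⊆tree′ v inTree
      ...   | inj₂ (inj₁ Pv)   = P⊆tree′ v Pv
      ...   | inj₂ (inj₂ Qv)   = Q⊆tree′ v Qv
      attached′ : ∀ v → X′ v ≡ true → ∃ λ c → C′ c ≡ true × c ~ v ≡ true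
      attached′ v X′v with ∨-elim {X v} (proj₁ (∧-elim {X v ∨ P v} X′v))
      ... | inj₁ Xv = let (c , Cc , cv) = attached v Xv in c , C⊆C′ c Cc , cv
      ... | inj₂ Pv = let (c , Qc , cv) = P-attached v Pv in c , ∨-introʳ {C c} Qc , cv
      reach′ : ∀ c → C′ c ≡ true → WalkIn G (Vec.tabulate C′) root c
      reach′ c C′c with ∨-elim {C c} C′c
      ... | inj₁ Cc = walk-lift C⊆C′ (reach c Cc)
      ... | inj₂ Qc = Q-reach c Qc

  module Expand (s : LeafyTree) where
    open LeafyTree s

    out : Fin n → Indicator n
    out = outNbrs C X

    out⇒~ : ∀ {x v} → out x v ≡ true → x ~ v ≡ true
    out⇒~ {x} {v} xv = proj₁ (∧-elim {x ~ v} xv)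

    out⇒∉tree : ∀ {x v} → out x v ≡ true → (C ∪ᵢ X) v ≡ false
    out⇒∉tree {x} {v} xv = not-elimᵗ (proj₂ (∧-elim {x ~ v} xv))

    out⇒∉C : ∀ {x} v → out x v ≡ true → C v ≡ false
    out⇒∉C v xv = ∨-falseˡ {C v} (out⇒∉tree xv)

    out⇒∉X : ∀ {x} v → out x v ≡ true → X v ≡ false
    out⇒∉X v xv = ∨-falseʳ {C v} (out⇒∉tree xv)

    out⁺ : ∀ {x v} → x ~ v ≡ true → (C ∪ᵢ X) v ≡ false → out x v ≡ true
    out⁺ xv v∉tree = ∧-intro xv (not-introᶠ v∉tree)

    out-irrefl : ∀ x → out x x ≡ false
    out-irrefl x rewrite Graph.irrefl G x = refl

    X⇒∉C : ∀ {x} → X x ≡ true → C x ≡ false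
    X⇒∉C {x} Xx = ≢true⇒≡false λ Cx → true≢false (trans (sym Xx) (disjoint x Cx))

    out⇒≢ : ∀ {x y} → X x ≡ true → out x y ≡ true → x ≢ y
    out⇒≢ Xx xy refl = true≢false (trans (sym Xx) (out⇒∉X _ xy))

    alive : ∀ {x} → 0 < count (out x) → deadLeaves C X x ≡ false
    alive {x} out≢∅ = trans (cong (X x ∧_) (dec-false (count (out x) ≟ 0) (λ e → <⇒≢ out≢∅ (sym e))))
                            (∧-zeroʳ (X x))

    reach-leaf : ∀ {C′} → C ⊆ᵢ C′ → ∀ {x} → X x ≡ true → C′ x ≡ true → WalkIn G (Vec.tabulate C′) root x
    reach-leaf {C′} C⊆C′ {x} Xx C′x = let (c , Cc , cx) = attached x Xx in
      walk-snoc G (walk-lift C⊆C′ (reach c Cc)) (T-≡ .Equivalence.from cx) (∈-tabulate⁺ C′ x C′x)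

    expand-branching-leaf : ∀ {x} → X x ≡ true → 2 ≤ count (out x) → Progress s
    expand-branching-leaf {x} Xx 2≤out =
      grow fresh (out⇒∉C) Q-closed P-attached Q-reach budget′ , progress w (P⊆tree′ w xw) (out⇒∉tree xw)
      where
      open Grow s x ⁅ x ⁆ᵢ (out x) (x∈⁅x⁆ᵢ x)
      w = proj₁ (count>0⇒witness (out x) (≤-trans (s≤s z≤n) 2≤out))
      xw = proj₂ (count>0⇒witness (out x) (≤-trans (s≤s z≤n) 2≤out))
      fresh : ∀ v → ⁅ x ⁆ᵢ v ≡ true → v ≢ x → (C ∪ᵢ X) v ≡ false × out x v ≡ false
      fresh v v∈⁅x⁆ v≢x = ⊥-elim (v≢x (x∈⁅y⁆ᵢ⇒x≡y v∈⁅x⁆))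
      Q-closed : ∀ c v → ⁅ x ⁆ᵢ c ≡ true → c ~ v ≡ true → (C ∪ᵢ X) v ≡ true ⊎ out x v ≡ true ⊎ ⁅ x ⁆ᵢ v ≡ true
      Q-closed c v c∈⁅x⁆ cv with x∈⁅y⁆ᵢ⇒x≡y {x = c} c∈⁅x⁆ | (C ∪ᵢ X) v in v∈?tree
      ... | refl | true  = inj₁ refl
      ... | refl | false = inj₂ (inj₁ (∧-intro cv refl))
      P-attached : ∀ v → out x v ≡ true → ∃ λ c → ⁅ x ⁆ᵢ c ≡ true × c ~ v ≡ true
      P-attached v xv = x , x∈⁅x⁆ᵢ x , out⇒~ xv
      Q-reach : ∀ c → ⁅ x ⁆ᵢ c ≡ true → WalkIn G (Vec.tabulate C′) root c
      Q-reach c c∈⁅x⁆ with refl ← x∈⁅y⁆ᵢ⇒x≡y {x = c} c∈⁅x⁆ = reach-leaf C⊆C′ Xx x∈C′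
      budget′ : count C′ ≤ 2 * count X′ + count (deadLeaves C′ X′)
      budget′ = subst (_≤ 2 * count X′ + count (deadLeaves C′ X′)) (sym (count-insert C x (X⇒∉C Xx)))
        (≤-trans (n≤1+n _) (budget-by-new-leaves budget (count-X′ Xx out⇒∉X) 2≤out
          (count-mono (deadLeaves⊆ (alive (≤-trans (s≤s z≤n) 2≤out))))))

    expand-leaf-and-branching-child : ∀ {x y} → X x ≡ true → count (out x) ≤ 1 → out x y ≡ true →
      2 ≤ count (out y) → Progress s
    expand-leaf-and-branching-child {x} {y} Xx out≤1 xy 2≤out =
      grow fresh (out⇒∉C) Q-closed P-attached Q-reach budget′ , progress y (Q⊆tree′ y y∈Q) (out⇒∉tree xy)
      where
      Q = ⁅ x ⁆ᵢ ∪ᵢ ⁅ y ⁆ᵢ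
      y∈Q : Q y ≡ true
      y∈Q = ∨-introʳ {⁅ x ⁆ᵢ y} (x∈⁅x⁆ᵢ y)
      open Grow s x Q (out y) (∨-introˡ (x∈⁅x⁆ᵢ x))
      fresh : ∀ v → Q v ≡ true → v ≢ x → (C ∪ᵢ X) v ≡ false × out y v ≡ false
      fresh v v∈Q v≢x with ∨-elim {⁅ x ⁆ᵢ v} v∈Q
      ... | inj₁ v∈⁅x⁆ = ⊥-elim (v≢x (x∈⁅y⁆ᵢ⇒x≡y v∈⁅x⁆))
      ... | inj₂ v∈⁅y⁆ with refl ← x∈⁅y⁆ᵢ⇒x≡y {x = v} v∈⁅y⁆ = out⇒∉tree xy , out-irrefl y
      Q-closed : ∀ c v → Q c ≡ true → c ~ v ≡ true → (C ∪ᵢ X) v ≡ true ⊎ out y v ≡ true ⊎ Q v ≡ true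
      Q-closed c v c∈Q cv with (C ∪ᵢ X) v in v∈?tree | ∨-elim {⁅ x ⁆ᵢ c} c∈Q
      ... | true  | _ = inj₁ refl
      ... | false | inj₁ c∈⁅x⁆ with refl ← x∈⁅y⁆ᵢ⇒x≡y {x = c} c∈⁅x⁆
                               with refl ← count≤1⇒unique (out x) out≤1 (out⁺ cv v∈?tree) xy = inj₂ (inj₂ y∈Q)
      ... | false | inj₂ c∈⁅y⁆ with refl ← x∈⁅y⁆ᵢ⇒x≡y {x = c} c∈⁅y⁆ = inj₂ (inj₁ (∧-intro cv refl))
      P-attached : ∀ v → out y v ≡ true → ∃ λ c → Q c ≡ true × c ~ v ≡ true
      P-attached v yv = y , y∈Q , out⇒~ yv
      reach-x : WalkIn G (Vec.tabulate C′) root x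
      reach-x = reach-leaf C⊆C′ Xx x∈C′
      Q-reach : ∀ c → Q c ≡ true → WalkIn G (Vec.tabulate C′) root c
      Q-reach c c∈Q with ∨-elim {⁅ x ⁆ᵢ c} c∈Q
      ... | inj₁ c∈⁅x⁆ with refl ← x∈⁅y⁆ᵢ⇒x≡y {x = c} c∈⁅x⁆ = reach-x
      ... | inj₂ c∈⁅y⁆ with refl ← x∈⁅y⁆ᵢ⇒x≡y {x = c} c∈⁅y⁆ =
        walk-snoc G reach-x (T-≡ .Equivalence.from (out⇒~ xy)) (∈-tabulate⁺ C′ c (∨-introʳ {C c} y∈Q))
      count-Q : count Q ≡ 2
      count-Q = trans (count-∪-disjoint ⁅ x ⁆ᵢ ⁅ y ⁆ᵢ ⁅x⁆∩⁅y⁆=∅) (cong₂ _+_ (count-⁅⁆ᵢ x) (count-⁅⁆ᵢ y))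
        where
        ⁅x⁆∩⁅y⁆=∅ : ∀ i → ⁅ x ⁆ᵢ i ≡ true → ⁅ y ⁆ᵢ i ≡ false
        ⁅x⁆∩⁅y⁆=∅ i i∈⁅x⁆ with refl ← x∈⁅y⁆ᵢ⇒x≡y {x = i} i∈⁅x⁆ = x≢y⇒x∉⁅y⁆ᵢ (out⇒≢ Xx xy)
      C∩Q=∅ : ∀ i → C i ≡ true → Q i ≡ false
      C∩Q=∅ i Ci = ≢true⇒≡false λ i∈Q → true≢false (trans (sym Ci) (Q⇒∉C i∈Q))
        where
        Q⇒∉C : Q i ≡ true → C i ≡ false
        Q⇒∉C i∈Q with ∨-elim {⁅ x ⁆ᵢ i} i∈Q
        ... | inj₁ i∈⁅x⁆ with refl ← x∈⁅y⁆ᵢ⇒x≡y {x = i} i∈⁅x⁆ = X⇒∉C Xx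
        ... | inj₂ i∈⁅y⁆ with refl ← x∈⁅y⁆ᵢ⇒x≡y {x = i} i∈⁅y⁆ = out⇒∉C i xy
      budget′ : count C′ ≤ 2 * count X′ + count (deadLeaves C′ X′)
      budget′ = subst (_≤ 2 * count X′ + count (deadLeaves C′ X′))
        (sym (trans (count-∪-disjoint C Q C∩Q=∅) (trans (cong (count C +_) count-Q) (+-comm (count C) 2))))
        (budget-by-new-leaves budget (count-X′ Xx out⇒∉X) 2≤out
          (count-mono (deadLeaves⊆ (alive (count>0 (out x) y xy)))))

    expand-leaf-creating-dead-leaf : ∀ {x y} → X x ≡ true → (∀ z → X z ≡ true → count (out z) ≤ 1) →
      out x y ≡ true → count (out y) ≤ 1 → count (y ~_) ≢ 2 → Progress s
    expand-leaf-creating-dead-leaf {x} {y} Xx no-branching xy out≤1 deg≢2 =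
      grow fresh P∩C=∅ Q-closed P-attached Q-reach budget′ , progress y (P⊆tree′ y (x∈⁅x⁆ᵢ y)) y∉tree
      where
      open Grow s x ⁅ x ⁆ᵢ ⁅ y ⁆ᵢ (x∈⁅x⁆ᵢ x)
      y∉tree = out⇒∉tree xy
      y≢x = out⇒≢ Xx xy ∘ sym
      fresh : ∀ v → ⁅ x ⁆ᵢ v ≡ true → v ≢ x → (C ∪ᵢ X) v ≡ false × ⁅ y ⁆ᵢ v ≡ false
      fresh v v∈⁅x⁆ v≢x = ⊥-elim (v≢x (x∈⁅y⁆ᵢ⇒x≡y v∈⁅x⁆))
      P∩C=∅ : ∀ v → ⁅ y ⁆ᵢ v ≡ true → C v ≡ false
      P∩C=∅ v v∈⁅y⁆ with refl ← x∈⁅y⁆ᵢ⇒x≡y {x = v} v∈⁅y⁆ = out⇒∉C v xy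
      Q-closed : ∀ c v → ⁅ x ⁆ᵢ c ≡ true → c ~ v ≡ true → (C ∪ᵢ X) v ≡ true ⊎ ⁅ y ⁆ᵢ v ≡ true ⊎ ⁅ x ⁆ᵢ v ≡ true
      Q-closed c v c∈⁅x⁆ cv with x∈⁅y⁆ᵢ⇒x≡y {x = c} c∈⁅x⁆ | (C ∪ᵢ X) v in v∈?tree
      ... | refl | true  = inj₁ refl
      ... | refl | false with refl ← count≤1⇒unique (out x) (no-branching x Xx) (out⁺ cv v∈?tree) xy =
        inj₂ (inj₁ (x∈⁅x⁆ᵢ y))
      P-attached : ∀ v → ⁅ y ⁆ᵢ v ≡ true → ∃ λ c → ⁅ x ⁆ᵢ c ≡ true × c ~ v ≡ true
      P-attached v v∈⁅y⁆ with refl ← x∈⁅y⁆ᵢ⇒x≡y {x = v} v∈⁅y⁆ = x , x∈⁅x⁆ᵢ x , out⇒~ xy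
      Q-reach : ∀ c → ⁅ x ⁆ᵢ c ≡ true → WalkIn G (Vec.tabulate C′) root c
      Q-reach c c∈⁅x⁆ with refl ← x∈⁅y⁆ᵢ⇒x≡y {x = c} c∈⁅x⁆ = reach-leaf C⊆C′ Xx x∈C′
      new-dead-leaf : ∃ λ w → deadLeaves C′ X′ w ≡ true × deadLeaves C X w ≡ false
      new-dead-leaf with count (y ~_) ≟ 1
      ... | yes deg≡1 = y , deadLeaf⁺ {C′} {X′} (X′-gains y (x∈⁅x⁆ᵢ y) y≢x) no-out , y-was-live
        where
        y-was-live : deadLeaves C X y ≡ false
        y-was-live rewrite out⇒∉X y xy = refl
        no-out : ∀ v → outNbrs C′ X′ y v ≡ false
        no-out v = ≢true⇒≡false λ yv →
          let (yv , v∉tree′) = ∧-elim {y ~ v} yv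
          in case count≤1⇒unique (y ~_) (≤-reflexive deg≡1) yv (~-sym (out⇒~ xy)) of λ where
               refl → true≢false (trans (sym (∨-introˡ x∈C′)) (not-elimᵗ v∉tree′))
      ... | no deg≢1 = x′ , deadLeaf⁺ {C′} {X′} (X′-keeps x′ Xx′ x′≢x) no-out , alive (count>0 (out x′) y x′y)
        where
        NX : Indicator n
        NX v = (y ~ v) ∧ X v
        N⊆out∪NX : (y ~_) ⊆ᵢ (out y ∪ᵢ NX)
        N⊆out∪NX v yv with (C ∪ᵢ X) v in v∈?tree
        ... | false = ∨-introˡ (∧-intro yv refl)
        ... | true with ∨-elim {C v} v∈?tree
        ...   | inj₁ Cv = ⊥-elim (true≢false (trans (sym (closed v y Cv (~-sym yv))) y∉tree))
        ...   | inj₂ Xv = ∨-introʳ (∧-intro yv Xv)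
        3≤deg : 3 ≤ count (y ~_)
        3≤deg with count (y ~_) | count>0 (y ~_) x (~-sym (out⇒~ xy))
        ... | suc zero          | _ = ⊥-elim (deg≢1 refl)
        ... | suc (suc zero)    | _ = ⊥-elim (deg≢2 refl)
        ... | suc (suc (suc _)) | _ = s≤s (s≤s (s≤s z≤n))
        2≤NX : 2 ≤ count NX
        2≤NX = +-cancelˡ-≤ 1 2 (count NX) (≤-trans 3≤deg (≤-trans (count-mono N⊆out∪NX)
                 (≤-trans (count-∪ (out y) NX) (+-monoˡ-≤ (count NX) out≤1))))
        x′ = proj₁ (count≥2⇒witness≢ NX 2≤NX x)
        yx′ = proj₁ (∧-elim {y ~ x′} (proj₁ (proj₂ (count≥2⇒witness≢ NX 2≤NX x))))
        Xx′ = proj₂ (∧-elim {y ~ x′} (proj₁ (proj₂ (count≥2⇒witness≢ NX 2≤NX x))))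
        x′≢x = proj₂ (proj₂ (count≥2⇒witness≢ NX 2≤NX x))
        x′y : out x′ y ≡ true
        x′y = out⁺ (~-sym yx′) y∉tree
        no-out : ∀ v → outNbrs C′ X′ x′ v ≡ false
        no-out v = ≢true⇒≡false λ x′v →
          let (x′v , v∉tree′) = ∧-elim {x′ ~ v} x′v
              v∉tree = ≢true⇒≡false λ v∈tree →
                         true≢false (trans (sym (tree⊆tree′ v v∈tree)) (not-elimᵗ v∉tree′))
          in case count≤1⇒unique (out x′) (no-branching x′ Xx′) (out⁺ x′v v∉tree) x′y of λ where
               refl → true≢false (trans (sym (P⊆tree′ y (x∈⁅x⁆ᵢ y))) (not-elimᵗ v∉tree′))
      budget′ : count C′ ≤ 2 * count X′ + count (deadLeaves C′ X′)
      budget′ = subst (_≤ 2 * count X′ + count (deadLeaves C′ X′)) (sym (count-insert C x (X⇒∉C Xx)))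
        (budget-by-new-dead-leaf budget
          (trans (count-X′ Xx (λ v v∈⁅y⁆ → subst (λ z → X z ≡ false) (sym (x∈⁅y⁆ᵢ⇒x≡y v∈⁅y⁆)) (out⇒∉X y xy)))
                 (cong (count X +_) (count-⁅⁆ᵢ y)))
          (count-strict (deadLeaves⊆ (alive (count>0 (out x) y xy))) (proj₁ new-dead-leaf)
                        (proj₁ (proj₂ new-dead-leaf)) (proj₂ (proj₂ new-dead-leaf))))

    grow-step : ConnectedGraph G → (∀ v → count (v ~_) ≢ 2) → ∀ v → (C ∪ᵢ X) v ≡ false → Progress s
    grow-step connected deg≢2 v v∉tree
      with crossing-edge G (C ∪ᵢ X) (proj₂ connected root v (∈-tabulate⁺ _ root refl) (∈-tabulate⁺ _ v refl))
                         (∨-introˡ root∈C) v∉tree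
    ... | a , b , a∈tree , b∉tree , ab = from-crossing
      where
      Xa : X a ≡ true
      Xa with ∨-elim {C a} a∈tree
      ... | inj₁ Ca = ⊥-elim (true≢false (trans (sym (closed a b Ca ab)) b∉tree))
      ... | inj₂ Xa = Xa
      without-branching-leaf : (∀ z → X z ≡ true → count (out z) ≤ 1) → Progress s
      without-branching-leaf no-branching with 2 ≤? count (out b)
      ... | yes 2≤out = expand-leaf-and-branching-child Xa (no-branching a Xa) (out⁺ ab b∉tree) 2≤out
      ... | no ¬2≤out = expand-leaf-creating-dead-leaf Xa no-branching (out⁺ ab b∉tree) (≤-pred (≰⇒> ¬2≤out))
                          (deg≢2 b)
      from-crossing : Progress s
      from-crossing with Fin.any? (λ z → (X z Bool.≟ true) ×-dec (2 ≤? count (out z)))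
      ... | yes (z , Xz , 2≤out) = expand-branching-leaf Xz 2≤out
      ... | no ∄branching = without-branching-leaf λ z Xz → ≤-pred (≰⇒> λ 2≤out → ∄branching (z , Xz , 2≤out))

  Spanning : LeafyTree → Set
  Spanning s = ∀ v → tree s v ≡ true

  grow-until-spanning : ConnectedGraph G → (∀ v → count (v ~_) ≢ 2) →
    ∀ k (s : LeafyTree) → n ≤ k + count (tree s) → Σ LeafyTree Spanning
  grow-until-spanning connected deg≢2 k s n≤k+size with Fin.any? (λ v → tree s v Bool.≟ false)
  ... | no none = s , λ v → ¬-not (λ v∉tree → none (v , v∉tree))
  ... | yes (v , v∉tree) with k
  ...   | zero  = ⊥-elim (<⇒≱ size<n n≤k+size)
    where
    size<n : count (tree s) < n
    size<n = subst (count (tree s) <_) (count-all n) (count-strict (λ _ _ → refl) v refl v∉tree)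
  ...   | suc k′ = grow-until-spanning connected deg≢2 k′ s′
                     (≤-trans n≤k+size (≤-trans (≤-reflexive (sym (+-suc k′ _))) (+-monoʳ-≤ k′ grows)))
    where
    s′ = proj₁ (Expand.grow-step s connected deg≢2 v v∉tree)
    grows = proj₂ (Expand.grow-step s connected deg≢2 v v∉tree)

  star : ConnectedGraph G → ∀ r v → v ≢ r → LeafyTree
  star connected r v v≢r = record
    { C = ⁅ r ⁆ᵢ ; X = r ~_ ; root = r ; root∈C = x∈⁅x⁆ᵢ r ; disjoint = disjoint ; closed = closed
    ; attached = λ x rx → r , x∈⁅x⁆ᵢ r , rx ; reach = reach ; budget = budget }
    where
    disjoint : ∀ v → ⁅ r ⁆ᵢ v ≡ true → r ~ v ≡ false
    disjoint v v∈⁅r⁆ with refl ← x∈⁅y⁆ᵢ⇒x≡y {x = v} v∈⁅r⁆ = Graph.irrefl G r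
    closed : ∀ c v → ⁅ r ⁆ᵢ c ≡ true → c ~ v ≡ true → (⁅ r ⁆ᵢ ∪ᵢ (r ~_)) v ≡ true
    closed c v c∈⁅r⁆ cv with refl ← x∈⁅y⁆ᵢ⇒x≡y {x = c} c∈⁅r⁆ = ∨-introʳ cv
    reach : ∀ c → ⁅ r ⁆ᵢ c ≡ true → WalkIn G (Vec.tabulate ⁅ r ⁆ᵢ) r c
    reach c c∈⁅r⁆ with refl ← x∈⁅y⁆ᵢ⇒x≡y {x = c} c∈⁅r⁆ = here (∈-tabulate⁺ ⁅ r ⁆ᵢ r (x∈⁅x⁆ᵢ r))
    deg>0 : 0 < count (r ~_)
    deg>0 with crossing-edge G ⁅ r ⁆ᵢ (proj₂ connected r v (∈-tabulate⁺ _ r refl) (∈-tabulate⁺ _ v refl))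
                 (x∈⁅x⁆ᵢ r) (x≢y⇒x∉⁅y⁆ᵢ v≢r)
    ... | a , b , a∈⁅r⁆ , _ , ab with refl ← x∈⁅y⁆ᵢ⇒x≡y {x = a} a∈⁅r⁆ = count>0 (r ~_) b ab
    budget : count ⁅ r ⁆ᵢ ≤ 2 * count (r ~_) + count (deadLeaves ⁅ r ⁆ᵢ (r ~_))
    budget = subst (_≤ 2 * count (r ~_) + count (deadLeaves ⁅ r ⁆ᵢ (r ~_))) (sym (count-⁅⁆ᵢ r))
               (≤-trans deg>0 (≤-trans (m≤m+n (count (r ~_)) _) (m≤m+n (2 * count (r ~_)) _)))

  -- Once C ∪ X is everything every leaf is dead, so the budget reads count C ≤ 3 · count X.
  n≤4*leaves : ∀ s → Spanning s → n ≤ 4 * count (LeafyTree.X s)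
  n≤4*leaves s spanning = begin
    n                                          ≡⟨ sym (count-all n) ⟩
    count {n} (λ _ → true)                     ≡⟨ count-cong (λ v → sym (spanning v)) ⟩
    count (C ∪ᵢ X)                             ≡⟨ count-∪-disjoint C X disjoint ⟩
    count C + count X                          ≤⟨ +-monoˡ-≤ (count X) budget ⟩
    2 * count X + count (deadLeaves C X) + count X   ≡⟨ cong (λ d → 2 * count X + d + count X) all-dead ⟩
    2 * count X + count X + count X            ≡⟨ regroup (count X) ⟩
    4 * count X                                ∎
    where
    open LeafyTree s
    open ≤-Reasoning
    regroup : ∀ a → 2 * a + a + a ≡ 4 * a
    regroup = solve-∀
    all-dead : count (deadLeaves C X) ≡ count X
    all-dead = count-cong λ v → trans (cong (X v ∧_) (dec-true (_ ≟ 0) (count-none (outNbrs C X v)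
                 λ w → trans (cong (λ b → (v ~ w) ∧ not b) (spanning w)) (∧-zeroʳ (v ~ w)))))
                 (∧-identityʳ (X v))

-- Counting connected sets

between : ∀ {m} → Subset m → Subset m → List (Subset m)
between []            []            = [] ∷ []
between (inside  ∷ c) (_       ∷ x) = map (inside ∷_) (between c x)
between (outside ∷ c) (inside  ∷ x) = map (outside ∷_) (between c x) ++ map (inside ∷_) (between c x)
between (outside ∷ c) (outside ∷ x) = map (outside ∷_) (between c x)

Empty-∩-tail : ∀ {m a b} {c x : Subset m} → Empty ((a ∷ c) ∩ (b ∷ x)) → Empty (c ∩ x)
Empty-∩-tail c∩x=∅ (i , i∈) = c∩x=∅ (suc i , there i∈)

length-between : ∀ {m} (c x : Subset m) → Empty (c ∩ x) → length (between c x) ≡ 2 ^ ∣ x ∣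
length-between []            []            _     = refl
length-between (inside  ∷ c) (inside  ∷ x) c∩x=∅ = ⊥-elim (c∩x=∅ (zero , here))
length-between (inside  ∷ c) (outside ∷ x) c∩x=∅ =
  trans (length-map _ (between c x)) (length-between c x (Empty-∩-tail {a = inside} {outside} c∩x=∅))
length-between (outside ∷ c) (inside  ∷ x) c∩x=∅ = begin-equality
  length (map (outside ∷_) (between c x) ++ map (inside ∷_) (between c x))
    ≡⟨ length-++ (map (outside ∷_) (between c x)) ⟩
  length (map (outside ∷_) (between c x)) + length (map (inside ∷_) (between c x))
    ≡⟨ cong₂ _+_ (length-map _ (between c x)) (length-map _ (between c x)) ⟩
  length (between c x) + length (between c x)
    ≡⟨ cong (λ k → k + k) (length-between c x (Empty-∩-tail {a = outside} {inside} c∩x=∅)) ⟩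
  2 ^ ∣ x ∣ + 2 ^ ∣ x ∣
    ≡⟨ cong (2 ^ ∣ x ∣ +_) (sym (+-identityʳ _)) ⟩
  2 ^ suc ∣ x ∣ ∎
  where open ≤-Reasoning
length-between (outside ∷ c) (outside ∷ x) c∩x=∅ =
  trans (length-map _ (between c x)) (length-between c x (Empty-∩-tail {a = outside} {outside} c∩x=∅))

∷-injective : ∀ {m b} {p q : Subset m} → (b ∷ p) ≡ (b ∷ q) → p ≡ q
∷-injective refl = refl

unique-between : ∀ {m} (c x : Subset m) → Unique (between c x)
unique-between []            []            = [] ∷ []
unique-between (inside  ∷ c) (_       ∷ x) = map⁺ ∷-injective (unique-between c x)
unique-between (outside ∷ c) (inside  ∷ x) =
  ++⁺ (map⁺ ∷-injective (unique-between c x)) (map⁺ ∷-injective (unique-between c x)) different-heads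
  where
  different-heads : ∀ {S} → ¬ (S ∈ˡ map (outside ∷_) (between c x) × S ∈ˡ map (inside ∷_) (between c x))
  different-heads (S∈₀ , S∈₁) with ∈-map⁻ (outside ∷_) S∈₀ | ∈-map⁻ (inside ∷_) S∈₁
  ... | _ , _ , refl | _ , _ , ()
unique-between (outside ∷ c) (outside ∷ x) = map⁺ ∷-injective (unique-between c x)

∈-between⁻ : ∀ {m} (c x : Subset m) {S} → S ∈ˡ between c x → c ⊆ S × S ⊆ c ∪ x
∈-between⁻ []            []            (here refl) = (λ ()) , (λ ())
∈-between⁻ (inside  ∷ c) (_       ∷ x) S∈ with ∈-map⁻ (inside ∷_) S∈
... | T , T∈ , refl = s⊆s (proj₁ (∈-between⁻ c x T∈)) , s⊆s (proj₂ (∈-between⁻ c x T∈))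
∈-between⁻ (outside ∷ c) (inside  ∷ x) S∈ with ∈-++⁻ (map (outside ∷_) (between c x)) S∈
... | inj₁ S∈₀ with ∈-map⁻ (outside ∷_) S∈₀
...   | T , T∈ , refl = s⊆s (proj₁ (∈-between⁻ c x T∈)) , out⊆ (proj₂ (∈-between⁻ c x T∈))
∈-between⁻ (outside ∷ c) (inside  ∷ x) S∈ | inj₂ S∈₁ with ∈-map⁻ (inside ∷_) S∈₁
...   | T , T∈ , refl = out⊆ (proj₁ (∈-between⁻ c x T∈)) , s⊆s (proj₂ (∈-between⁻ c x T∈))
∈-between⁻ (outside ∷ c) (outside ∷ x) S∈ with ∈-map⁻ (outside ∷_) S∈
... | T , T∈ , refl = s⊆s (proj₁ (∈-between⁻ c x T∈)) , s⊆s (proj₂ (∈-between⁻ c x T∈))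

lookup-injective : ∀ {A : Set} (xs : List A) → Unique xs → ∀ i j → List.lookup xs i ≡ List.lookup xs j → i ≡ j
lookup-injective (x ∷ xs) (x∉ ∷ u) zero    zero    _ = refl
lookup-injective (x ∷ xs) (x∉ ∷ u) zero    (suc j) e = ⊥-elim (All.lookup x∉ (∈-lookup j) e)
lookup-injective (x ∷ xs) (x∉ ∷ u) (suc i) zero    e = ⊥-elim (All.lookup x∉ (∈-lookup i) (sym e))
lookup-injective (x ∷ xs) (x∉ ∷ u) (suc i) (suc j) e = cong suc (lookup-injective xs u i j e)

unique-⊆⇒length≤ : ∀ {A : Set} (xs ys : List A) → Unique xs → (∀ {z} → z ∈ˡ xs → z ∈ˡ ys) → length xs ≤ length ys
unique-⊆⇒length≤ xs ys u xs⊆ys = Fin.injective⇒≤ {f = position} position-injective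
  where
  position : Fin (length xs) → Fin (length ys)
  position i = Any.index (xs⊆ys (∈-lookup i))
  position-injective : ∀ {i j} → position i ≡ position j → i ≡ j
  position-injective {i} {j} e = lookup-injective xs u i j
    (trans (lookup-index (xs⊆ys (∈-lookup i)))
           (trans (cong (List.lookup ys) e) (sym (lookup-index (xs⊆ys (∈-lookup j))))))

module _ {n : ℕ} (G : Graph n) where
  open LeafyTrees G

  connected-between : ∀ s {S} → S ∈ˡ between (Vec.tabulate (LeafyTree.C s)) (Vec.tabulate (LeafyTree.X s)) →
    ConnectedSet G S
  connected-between s {S} S∈ = (root , C⊆S (∈-tabulate⁺ C root root∈C)) ,
                               λ u v u∈S v∈S → walk-++ G (walk-reverse G (from-root u∈S)) (from-root v∈S)
    where
    open LeafyTree s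
    C⊆S = proj₁ (∈-between⁻ (Vec.tabulate C) (Vec.tabulate X) S∈)
    S⊆C∪X = proj₂ (∈-between⁻ (Vec.tabulate C) (Vec.tabulate X) S∈)
    within-S : ∀ {u} → WalkIn G (Vec.tabulate C) root u → WalkIn G S root u
    within-S = walk-mono G (λ _ → C⊆S)
    from-root : ∀ {u} → u ∈ S → WalkIn G S root u
    from-root {u} u∈S with x∈p∪q⁻ (Vec.tabulate C) (Vec.tabulate X) (S⊆C∪X u∈S)
    ... | inj₁ u∈C = within-S (reach u (∈-tabulate⁻ C u u∈C))
    ... | inj₂ u∈X = let (c , Cc , cu) = attached u (∈-tabulate⁻ X u u∈X) in
                     walk-snoc G (within-S (reach c Cc)) (T-≡ .Equivalence.from cu) u∈S

  connected-singleton : ∀ x → ConnectedSet G ⁅ x ⁆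
  connected-singleton x = (x , x∈⁅x⁆ x) , λ u v u∈ v∈ → case x∈⁅y⁆⇒x≡y x u∈ , x∈⁅y⁆⇒x≡y x v∈ of λ where
    (refl , refl) → here u∈

  -- The distinct connected sets C ∪ Y for Y ⊆ X, and {x₀} for a leaf x₀.
  connected-sets-from-leaves : ∀ s → 0 < count (LeafyTree.X s) → (L : List (Subset n)) →
    EnumeratesConnectedSets G L → suc (2 ^ count (LeafyTree.X s)) ≤ length L
  connected-sets-from-leaves s X≢∅ L (_ , enumerates) =
    subst (_≤ length L) length-M (unique-⊆⇒length≤ M L unique-M M⊆L)
    where
    open LeafyTree s
    c = Vec.tabulate C
    x = Vec.tabulate X
    x₀ = proj₁ (count>0⇒witness X X≢∅)
    M = ⁅ x₀ ⁆ ∷ between c x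
    root∉⁅x₀⁆ : ∀ {S} → S ∈ˡ between c x → ⁅ x₀ ⁆ ≢ S
    root∉⁅x₀⁆ S∈ refl with x∈⁅y⁆⇒x≡y x₀ (proj₁ (∈-between⁻ c x S∈) (∈-tabulate⁺ C root root∈C))
    ... | refl = true≢false (trans (sym (proj₂ (count>0⇒witness X X≢∅))) (disjoint root root∈C))
    unique-M : Unique M
    unique-M = All.tabulate root∉⁅x₀⁆ ∷ unique-between c x
    M⊆L : ∀ {S} → S ∈ˡ M → S ∈ˡ L
    M⊆L (here refl) = Equivalence.from (enumerates ⁅ x₀ ⁆) (connected-singleton x₀)
    M⊆L {S} (there S∈) = Equivalence.from (enumerates S) (connected-between s S∈)
    c∩x=∅ : Empty (c ∩ x)
    c∩x=∅ (i , i∈c∩x) = let (i∈c , i∈x) = x∈p∩q⁻ c x i∈c∩x in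
      true≢false (trans (sym (∈-tabulate⁻ X i i∈x)) (disjoint i (∈-tabulate⁻ C i i∈c)))
    length-M : length M ≡ suc (2 ^ count X)
    length-M = cong suc (trans (length-between c x c∩x=∅) (cong (2 ^_) (count-tabulate X)))

  many-connected-sets : 2 ≤ n → ConnectedGraph G → (∀ v → degree G v ≢ 2) →
    (L : List (Subset n)) → EnumeratesConnectedSets G L → 2 ^ n < length L ^ 4
  many-connected-sets 2≤n@(s≤s (s≤s _)) connected deg≢2 L enumerates = begin-strict
    2 ^ n                  ≤⟨ ^-monoʳ-≤ 2 n≤4ℓ ⟩
    2 ^ (4 * ℓ)            ≡⟨ ^[4*k]≡[^k]^4 2 ℓ ⟩
    (2 ^ ℓ) ^ 4            <⟨ ^-monoˡ-< 4 (n<1+n (2 ^ ℓ)) ⟩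
    suc (2 ^ ℓ) ^ 4        ≤⟨ ^-monoˡ-≤ 4 (connected-sets-from-leaves s ℓ>0 L enumerates) ⟩
    length L ^ 4           ∎
    where
    open ≤-Reasoning
    deg≢2′ : ∀ v → count (v ~_) ≢ 2
    deg≢2′ v = deg≢2 v ∘ trans (count-tabulate (adj G v))
    spanning = grow-until-spanning connected deg≢2′ n (star connected zero (suc zero) (λ ())) (m≤m+n n _)
    s = proj₁ spanning
    ℓ = count (LeafyTree.X s)
    n≤4ℓ : n ≤ 4 * ℓ
    n≤4ℓ = n≤4*leaves s (proj₂ spanning)
    ℓ>0 : 0 < ℓ
    ℓ>0 = n≢0⇒n>0 λ { ℓ≡0 → <⇒≱ z<s (subst (λ k → n ≤ 4 * k) ℓ≡0 n≤4ℓ) }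

-- The numerical bound on α*

square : ℕ → ℕ
square r = r * r

powᵇ : ℕ → ℕᵇ → ℕ
powᵇ m ℕᵇ.zero  = 1
powᵇ m 2[1+ b ] = square (m * powᵇ m b)
powᵇ m 1+[2 b ] = m * square (powᵇ m b)

^-double : ∀ m k → m ^ (2 * k) ≡ square (m ^ k)
^-double m k = trans (cong (λ j → m ^ (k + j)) (+-identityʳ k)) (^-distribˡ-+-* m k k)

powᵇ-correct : ∀ m b → powᵇ m b ≡ m ^ toℕ b
powᵇ-correct m ℕᵇ.zero  = refl
powᵇ-correct m 2[1+ b ] =
  trans (cong (λ r → square (m * r)) (powᵇ-correct m b)) (sym (^-double m (suc (toℕ b))))
powᵇ-correct m 1+[2 b ] =
  cong (m *_) (trans (cong square (powᵇ-correct m b)) (sym (^-double m (toℕ b))))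

-- Exponentiation by squaring: the powers compared in the bound on α* have about two million digits.
fastPow : ℕ → ℕ → ℕ
fastPow m e = powᵇ m (fromℕ e)

^≡fastPow : ∀ m e → m ^ e ≡ fastPow m e
^≡fastPow m e = sym (trans (powᵇ-correct m (fromℕ e)) (cong (m ^_) (toℕ-fromℕ e)))

fNum<2^q*fDenᵇ : ℕ → ℕ → Bool
fNum<2^q*fDenᵇ p q =
  fastPow q (4 * q) <ᵇ fastPow 2 q * (fastPow p (4 * p) * fastPow (q ∸ p) (4 * (q ∸ p)))

fNum<2^q*fDen-sound : ∀ p q → T (fNum<2^q*fDenᵇ p q) → fNum p q < 2 ^ q * fDen p q
fNum<2^q*fDen-sound p q t = subst₂ _<_ (sym (^≡fastPow q (4 * q)))
  (sym (cong₂ _*_ (^≡fastPow 2 q) (cong₂ _*_ (^≡fastPow p (4 * p)) (^≡fastPow (q ∸ p) (4 * (q ∸ p))))))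
  (<ᵇ⇒< _ _ t)

alphaStar<0·95831 : AlphaStarLt 95831 100000
alphaStar<0·95831 = inj₂ (≤ᵇ⇒≤ _ _ tt , fNum<2^q*fDen-sound 95831 100000 tt)

mainTheorem9 : (∀ (n : ℕ) (G : Graph n) → 2 ≤ n → ConnectedGraph G
                   → (∀ (v : Fin n) → degree G v ≢ 2)
                   → (L : List (Subset n)) → EnumeratesConnectedSets G L
                   → LtAlphaStar (totalSize L) (n * length L))
                 × AlphaStarLt 95831 100000
mainTheorem9 = density-bound , alphaStar<0·95831
  where
  density-bound : ∀ n (G : Graph n) → 2 ≤ n → ConnectedGraph G → (∀ v → degree G v ≢ 2) →
    (L : List (Subset n)) → EnumeratesConnectedSets G L → LtAlphaStar (totalSize L) (n * length L)
  density-bound n G 2≤n connected deg≢2 L enumerates@(unique , _) =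
    density<α* n (length L) (totalSize L) (zeros L) (totalSize+zeros L) (entropy-bound n L unique)
      (many-connected-sets G 2≤n connected deg≢2 L enumerates)
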